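{- Let $w$ be an integer, let $(\mathcal{S}=(S_0,\dots,S_\ell),\mathscr{P})$ be a path of well-linked sets of width at least $2w$ and length $\ell$ in a digraph $D$, and let $\mathcal{R}$ be a $B(S_\ell)$-$A(S_0)$-linkage of order $2w$ in $D$. Let $0\le i\le j\le \ell$. Then there is a $B(S_j)$-$A(S_i)$-linkage $\mathcal{R}'$ of order $w$ in $D$ such that every vertex and arc of $\mathcal{R}'$ that lies in $\mathrm{Sub}_{i,j}(\mathcal{S},\mathscr{P})$ lies in the union of $\mathcal{R}$ and the vertex set $\mathrm{Start}(\mathcal{R}')\cup\mathrm{End}(\mathcal{R}')$.
   Context: A linkage is a set of pairwise vertex-disjoint directed paths; order = number of paths; $\mathrm{Start}(\mathcal{L})$ and $\mathrm{End}(\mathcal{L})$ are the sets of first and last vertices of its paths; an $X$-$Y$-linkage has all paths starting in $X$ and ending in $Y$; a linkage is internally disjoint from a subgraph $H$ if it meets $H$ only in path endpoints. $A$ is well-linked to $B$ in $G$ if for all $A'\subseteq A$, $B'\subseteq B$ with $|A'|=|B'|$ there is an $A'$-$B'$-linkage of order $|A'|$ in $G$. A path of well-linked sets of width $w$ and length $\ell$ is $(\mathcal{S},\mathscr{P})$ with pairwise disjoint subgraphs (clusters) $S_0,\dots,S_\ell$, each having disjoint vertex sets $A(S_i),B(S_i)$ of size $w$ with $A(S_i)$ well-linked to $B(S_i)$ in $S_i$, and pairwise disjoint linkages $\mathcal{P}_0,\dots,\mathcal{P}_{\ell-1}$, where $\mathcal{P}_i$ is a $B(S_i)$-$A(S_{i+1})$-linkage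 of order $w$, internally disjoint from $S_i$ and $S_{i+1}$ and disjoint from every other cluster. For $0\le i\le j\le\ell$, $\mathrm{Sub}_{i,j}(\mathcal{S},\mathscr{P})$ denotes the subgraph formed by the clusters $S_i,\dots,S_j$ and the linkages $\mathcal{P}_i,\dots,\mathcal{P}_{j-1}$ (itself a path of well-linked sets). -}

module Defs where

open import Data.Nat using (ℕ; zero; suc; _≤_; _<_)
open import Data.Fin using (Fin; toℕ; inject₁) renaming (suc to fsuc)
open import Data.Fin.Subset using (Subset; ∣_∣) renaming (_∈_ to _∈ₛ_; _⊆_ to _⊆ₛ_)
open import Data.List using (List; []; _∷_; length)
open import Data.List.Membership.Propositional using (_∈_)
open import Data.List.Relation.Unary.Linked using (Linked)
open import Data.List.Relation.Unary.Unique.Propositional using (Unique)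
open import Data.List.Relation.Unary.AllPairs using (AllPairs)
open import Data.List.Relation.Unary.All using (All)
open import Data.Product using (Σ; ∃; ∃-syntax; _×_; _,_)
open import Data.Sum using (_⊎_)
open import Relation.Binary.PropositionalEquality using (_≡_; _≢_)
open import Relation.Nullary using (¬_)

-- A digraph D is given by a vertex count n (vertices are Fin n) and an
-- arc relation E : Fin n → Fin n → Set (arc u → v iff E u v).

lastOf : ∀ {n} → Fin n → List (Fin n) → Fin n
lastOf x []       = x
lastOf x (y ∷ ys) = lastOf y ys

Consec : ∀ {n} → List (Fin n) → Fin n → Fin n → Set
Consec []           u v = Data.Empty.⊥ where import Data.Empty
Consec (x ∷ [])     u v = Data.Empty.⊥ where import Data.Empty
Consec (x ∷ y ∷ zs) u v = (x ≡ u × y ≡ v) ⊎ Consec (y ∷ zs) u v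

module _ {n : ℕ} (E : Fin n → Fin n → Set) where

  record Path : Set where
    constructor mkPath
    field
      first  : Fin n
      rest   : List (Fin n)
      unique : Unique (first ∷ rest)
      arcs   : Linked E (first ∷ rest)

  record Subgraph : Set₁ where
    field
      vs       : Subset n
      as       : Fin n → Fin n → Set
      as⊆E     : ∀ {u v} → as u v → E u v
      as-ends  : ∀ {u v} → as u v → (u ∈ₛ vs) × (v ∈ₛ vs)

  verts : Path → List (Fin n)
  verts p = Path.first p ∷ Path.rest p

  start : Path → Fin n
  start p = Path.first p

  end : Path → Fin n
  end p = lastOf (Path.first p) (Path.rest p)

  OnPath : Path → Fin n → Set
  OnPath p v = v ∈ verts p

  ArcOnPath : Path → Fin n → Fin n → Set
  ArcOnPath p u v = Consec (verts p) u v

  record Linkage : Set where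
    constructor mkLinkage
    field
      paths    : List Path
      disjoint : AllPairs (λ p q → ∀ v → OnPath p v → ¬ OnPath q v) paths

  order : Linkage → ℕ
  order L = length (Linkage.paths L)

  VertexOf : Linkage → Fin n → Set
  VertexOf L v = ∃[ p ] (p ∈ Linkage.paths L × OnPath p v)

  ArcOf : Linkage → Fin n → Fin n → Set
  ArcOf L u v = ∃[ p ] (p ∈ Linkage.paths L × ArcOnPath p u v)

  InStartEnd : Linkage → Fin n → Set
  InStartEnd L v = ∃[ p ] (p ∈ Linkage.paths L × (start p ≡ v ⊎ end p ≡ v))

  IsLinkageFromTo : Subset n → Subset n → Linkage → Set
  IsLinkageFromTo X Y L = All (λ p → (start p ∈ₛ X) × (end p ∈ₛ Y)) (Linkage.paths L)

  LinkageIn : Subgraph → Linkage → Set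
  LinkageIn H L = (∀ v → VertexOf L v → v ∈ₛ Subgraph.vs H)
                × (∀ u v → ArcOf L u v → Subgraph.as H u v)

  InternallyDisjoint : Linkage → Subgraph → Set
  InternallyDisjoint L H =
    ∀ p → p ∈ Linkage.paths L → ∀ v → OnPath p v → v ∈ₛ Subgraph.vs H →
      (start p ≡ v ⊎ end p ≡ v)

  DisjointFrom : Linkage → Subgraph → Set
  DisjointFrom L H = ∀ v → VertexOf L v → ¬ (v ∈ₛ Subgraph.vs H)

  LinkagesDisjoint : Linkage → Linkage → Set
  LinkagesDisjoint L M = ∀ v → VertexOf L v → ¬ VertexOf M v

  WellLinked : Subset n → Subset n → Subgraph → Set
  WellLinked A B S =
    ∀ A' B' → A' ⊆ₛ A → B' ⊆ₛ B → ∣ A' ∣ ≡ ∣ B' ∣ →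
      Σ Linkage λ L → IsLinkageFromTo A' B' L × LinkageIn S L × order L ≡ ∣ A' ∣

  record PathOfWellLinkedSets (w ℓ : ℕ) : Set₁ where
    field
      S  : Fin (suc ℓ) → Subgraph
      A  : Fin (suc ℓ) → Subset n
      B  : Fin (suc ℓ) → Subset n
      P  : Fin ℓ → Linkage
      clusters-disjoint : ∀ i j → i ≢ j → ∀ v →
        v ∈ₛ Subgraph.vs (S i) → ¬ (v ∈ₛ Subgraph.vs (S j))
      A⊆S : ∀ i → A i ⊆ₛ Subgraph.vs (S i)
      B⊆S : ∀ i → B i ⊆ₛ Subgraph.vs (S i)
      ∣A∣ : ∀ i → ∣ A i ∣ ≡ w
      ∣B∣ : ∀ i → ∣ B i ∣ ≡ w
      A∩B : ∀ i v → v ∈ₛ A i → ¬ (v ∈ₛ B i)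
      wellLinked : ∀ i → WellLinked (A i) (B i) (S i)
      P-linkage : ∀ k → IsLinkageFromTo (B (inject₁ k)) (A (fsuc k)) (P k)
      P-order : ∀ k → order (P k) ≡ w
      P-int-disj-left  : ∀ k → InternallyDisjoint (P k) (S (inject₁ k))
      P-int-disj-right : ∀ k → InternallyDisjoint (P k) (S (fsuc k))
      P-disj-others : ∀ k (m : Fin (suc ℓ)) → m ≢ inject₁ k → m ≢ fsuc k →
        DisjointFrom (P k) (S m)
      P-disjoint : ∀ k k' → k ≢ k' → LinkagesDisjoint (P k) (P k')

  module _ {w ℓ : ℕ} (SP : PathOfWellLinkedSets w ℓ) where
    open PathOfWellLinkedSets SP

    SubVertex : Fin (suc ℓ) → Fin (suc ℓ) → Fin n → Set
    SubVertex i j v =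
      (∃[ m ] (toℕ i ≤ toℕ m × toℕ m ≤ toℕ j × v ∈ₛ Subgraph.vs (S m)))
      ⊎ (∃[ k ] (toℕ i ≤ toℕ k × toℕ k < toℕ j × VertexOf (P k) v))

    SubArc : Fin (suc ℓ) → Fin (suc ℓ) → Fin n → Fin n → Set
    SubArc i j u v =
      (∃[ m ] (toℕ i ≤ toℕ m × toℕ m ≤ toℕ j × Subgraph.as (S m) u v))
      ⊎ (∃[ k ] (toℕ i ≤ toℕ k × toℕ k < toℕ j × ArcOf (P k) u v))

-- Routing through the clusters S_j, …, S_ℓ (inside a cluster by well-linkedness, between clusters
-- along the linkages P_k) gives W disjoint walks from B(S_j) to B(S_ℓ); symmetrically there are W
-- disjoint walks from A(S_0) to A(S_i). Prolonging each path of R by the walk ending at its start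
-- and the walk leaving its end yields 2w walks from B(S_j) to A(S_i) whose R-parts are pairwise
-- disjoint and whose remaining parts are pairwise disjoint, so no set of fewer than w vertices meets
-- all of them. Menger's theorem in the union of these walks, with the arcs into B(S_j) and out of
-- A(S_i) deleted, gives w disjoint B(S_j)–A(S_i) paths. The two walk systems meet Sub_{i,j} only in
-- B(S_j) and A(S_i) respectively, so inside Sub_{i,j} such a path can only run along R.
module Submission where

open import Data.Empty using (⊥; ⊥-elim)
open import Data.Fin using (Fin; toℕ; zero; fromℕ; inject₁) renaming (suc to fsuc)
open import Data.Fin.Induction using (<-weakInduction; >-weakInduction)
open import Data.Fin.Properties using (any?; toℕ-injective; toℕ-inject₁) renaming (_≟_ to _≟ᶠ_; suc-injective to fsuc-injective)
open import Data.Fin.Subset using (Subset; ∣_∣; ⁅_⁆; _∪_; _∩_; _-_; inside; outside)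
  renaming (_∈_ to _∈ₛ_; _∉_ to _∉ₛ_)
open import Data.Fin.Subset.Properties
  using (_∈?_; x∈⁅x⁆; x∈⁅y⁆⇒x≡y; ∣⁅x⁆∣≡1; x∈p∪q⁺; x∈p∪q⁻; x∈p∩q⁺; x∈p∩q⁻; x∈p∧x≢y⇒x∈p-y; x∈p⇒∣p-x∣<∣p∣; anySubset?)
open import Data.List using (List; []; _∷_; _++_; length; map; concat; take; filter)
open import Data.List.Properties using (length-map; length-take)
open import Data.List.Membership.Propositional using (_∈_; _∉_; mapWith∈; find; lose)
open import Data.List.Membership.Propositional.Properties using (∈-map⁻; ∈-map⁺; ∈-++⁻; ∈-++⁺ˡ; ∈-++⁺ʳ; ∈-filter⁺; ∈-filter⁻; ∈-concat⁺′; ∈-concat⁻′)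
import Data.List.Membership.DecPropositional as DecMembership
open import Data.List.Relation.Binary.Subset.Propositional using (_⊆_)
open import Data.List.Relation.Unary.All as All using (All; []; _∷_)
import Data.List.Relation.Unary.All.Properties as All
open import Data.List.Relation.Unary.AllPairs as AllPairs using (AllPairs; []; _∷_)
import Data.List.Relation.Unary.AllPairs.Properties as AllPairs
open import Data.List.Relation.Unary.Any as Any using (Any; here; there)
open import Data.List.Relation.Unary.Linked as Linked using (Linked; []; [-]; _∷_)
open import Data.List.Relation.Unary.Unique.Propositional using (Unique)
import Data.List.Relation.Unary.Unique.Propositional.Properties as Unique
open import Data.Nat using (ℕ; zero; suc; _+_; _*_; _⊓_; _≤_; _<_; z≤n; s≤s; s≤s⁻¹; _≤?_)
open import Data.Nat.Properties
open import Data.Nat.DivMod using (_%_; [m+kn]%n≡m%n; m*n%n≡0)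
open import Data.Product using (Σ; ∃-syntax; _×_; _,_; proj₁; proj₂)
open import Data.Sum using (_⊎_; inj₁; inj₂; [_,_])
import Data.Sum
open import Data.Unit using (⊤; tt)
open import Data.Vec as Vec using ([]; _∷_)
open import Function using (_∘_)
open import Relation.Binary.PropositionalEquality hiding ([_])
open import Relation.Nullary using (¬_; Dec; yes; no)
open import Relation.Nullary.Decidable using (_×-dec_; _⊎-dec_; ¬?; decidable-stable)

open import Defs

-- Walks as vertex lists

module _ {n : ℕ} where

  lastOf-++ : ∀ (x : Fin n) xs ys → lastOf x (xs ++ ys) ≡ lastOf (lastOf x xs) ys
  lastOf-++ x []       ys = refl
  lastOf-++ x (y ∷ xs) ys = lastOf-++ y xs ys

  lastOf-∈ : ∀ (x : Fin n) xs → lastOf x xs ∈ x ∷ xs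
  lastOf-∈ x []       = here refl
  lastOf-∈ x (y ∷ xs) = there (lastOf-∈ y xs)

  AllButLast : (Fin n → Set) → Fin n → List (Fin n) → Set
  AllButLast P x []       = ⊤
  AllButLast P x (y ∷ ys) = P x × AllButLast P y ys

  AllButLast-map : ∀ {P Q : Fin n → Set} → (∀ {v} → P v → Q v) → ∀ {x} xs → AllButLast P x xs → AllButLast Q x xs
  AllButLast-map f []       _        = tt
  AllButLast-map f (y ∷ xs) (p , ps) = f p , AllButLast-map f xs ps

  All⇒AllButLast : ∀ {P : Fin n → Set} {x} xs → All P (x ∷ xs) → AllButLast P x xs
  All⇒AllButLast []       _        = tt
  All⇒AllButLast (y ∷ xs) (p ∷ ps) = p , All⇒AllButLast xs ps

  AllButLast∧last⇒All : ∀ {P : Fin n → Set} {x} xs → AllButLast P x xs → P (lastOf x xs) → All P (x ∷ xs)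
  AllButLast∧last⇒All []       _        p = p ∷ []
  AllButLast∧last⇒All (y ∷ xs) (p , ps) q = p ∷ AllButLast∧last⇒All xs ps q

  AllButLast-avoids⇒≡last : ∀ {T : Subset n} {x v} xs → AllButLast (_∉ₛ T) x xs → v ∈ x ∷ xs → v ∈ₛ T → v ≡ lastOf x xs
  AllButLast-avoids⇒≡last []       _        (here v≡x) _   = v≡x
  AllButLast-avoids⇒≡last (y ∷ xs) (x∉T , _) (here refl) v∈T = ⊥-elim (x∉T v∈T)
  AllButLast-avoids⇒≡last (y ∷ xs) (_ , ps) (there v∈)  v∈T = AllButLast-avoids⇒≡last xs ps v∈ v∈T

  All-avoids⇒≡first : ∀ {T : Subset n} {x v} xs → All (_∉ₛ T) xs → v ∈ x ∷ xs → v ∈ₛ T → v ≡ x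
  All-avoids⇒≡first xs _  (here v≡x) _   = v≡x
  All-avoids⇒≡first xs ps (there v∈) v∈T = ⊥-elim (All.lookup ps v∈ v∈T)

  module _ {E : Fin n → Fin n → Set} where

    linked-join : ∀ {x} xs {ys} → Linked E (x ∷ xs) → Linked E (lastOf x xs ∷ ys) → Linked E (x ∷ xs ++ ys)
    linked-join []       _       l = l
    linked-join (y ∷ xs) (e ∷ l) l′ = e ∷ linked-join xs l l′

    ∈rest⇒arcInto : ∀ {x xs v} → Linked E (x ∷ xs) → v ∈ xs → ∃[ u ] E u v
    ∈rest⇒arcInto (e ∷ _) (here refl) = _ , e
    ∈rest⇒arcInto (_ ∷ l) (there v∈)  = ∈rest⇒arcInto l v∈

    ∈⇒last⊎arcOut : ∀ {x xs v} → Linked E (x ∷ xs) → v ∈ x ∷ xs → v ≡ lastOf x xs ⊎ ∃[ u ] E v u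
    ∈⇒last⊎arcOut [-]     (here refl) = inj₁ refl
    ∈⇒last⊎arcOut (e ∷ _) (here refl) = inj₂ (_ , e)
    ∈⇒last⊎arcOut (_ ∷ l) (there v∈)  = ∈⇒last⊎arcOut l v∈

    linked-tails : ∀ {P x xs} → Linked E (x ∷ xs) → AllButLast P x xs → Linked (λ u v → P u × E u v) (x ∷ xs)
    linked-tails [-]     _        = [-]
    linked-tails (e ∷ l) (p , ps) = (p , e) ∷ linked-tails l ps

    linked-heads : ∀ {P : Fin n → Set} {x xs} → Linked E (x ∷ xs) → All P xs → Linked (λ u v → P v × E u v) (x ∷ xs)
    linked-heads [-]     _        = [-]
    linked-heads (e ∷ l) (p ∷ ps) = (p , e) ∷ linked-heads l ps

    prefixUpTo : ∀ {P : Fin n → Set} {v} x xs → v ∈ x ∷ xs → Linked E (x ∷ xs) → AllButLast P x xs →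
      ∃[ ys ] Linked E (x ∷ ys) × lastOf x ys ≡ v × AllButLast P x ys
    prefixUpTo x xs       (here refl) _       _        = [] , [-] , refl , tt
    prefixUpTo x (y ∷ xs) (there v∈)  (e ∷ l) (p , ps) with prefixUpTo y xs v∈ l ps
    ... | ys , l′ , last≡v , ps′ = y ∷ ys , e ∷ l′ , last≡v , p , ps′

    suffixFrom : ∀ {P : Fin n → Set} {v} x xs → v ∈ x ∷ xs → Linked E (x ∷ xs) → All P xs →
      ∃[ zs ] Linked E (v ∷ zs) × lastOf v zs ≡ lastOf x xs × All P zs
    suffixFrom x xs       (here refl) l       ps       = xs , l , refl , ps
    suffixFrom x (y ∷ xs) (there v∈)  (_ ∷ l) (_ ∷ ps) = suffixFrom y xs v∈ l ps

    record FirstHit (T : Subset n) (x : Fin n) (xs : List (Fin n)) : Set₁ where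
      constructor firstHitAt
      field
        prefix   : List (Fin n)
        linked   : Linked E (x ∷ prefix)
        avoids   : AllButLast (_∉ₛ T) x prefix
        lastInT  : lastOf x prefix ∈ₛ T
        ⊆whole   : x ∷ prefix ⊆ x ∷ xs
        unique   : Unique (x ∷ xs) → Unique (x ∷ prefix)
        All-rest : ∀ {Q : Fin n → Set} → All Q xs → All Q prefix

    firstHit : ∀ (T : Subset n) x xs → Linked E (x ∷ xs) → All (_∉ₛ T) (x ∷ xs) ⊎ FirstHit T x xs
    firstHit T x xs l with x ∈? T
    ... | yes x∈T = inj₂ (firstHitAt [] [-] tt x∈T (λ { (here refl) → here refl }) (λ _ → [] ∷ []) (λ _ → []))
    firstHit T x []       l       | no x∉T = inj₁ (x∉T ∷ [])
    firstHit T x (y ∷ xs) (e ∷ l) | no x∉T with firstHit T y xs l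
    ... | inj₁ avoids = inj₁ (x∉T ∷ avoids)
    ... | inj₂ (firstHitAt ys l′ avoids lastInT ⊆whole unique All-rest) =
      inj₂ (firstHitAt (y ∷ ys) (e ∷ l′) (x∉T , avoids) lastInT
        (λ { (here refl) → here refl ; (there v∈) → there (⊆whole v∈) })
        (λ { (x∉ ∷ u) → All.anti-mono ⊆whole x∉ ∷ unique u })
        (λ { (q ∷ qs) → q ∷ All-rest qs }))

    record LastHit (T : Subset n) (x : Fin n) (xs : List (Fin n)) : Set where
      constructor lastHitAt
      field
        first    : Fin n
        suffix   : List (Fin n)
        firstInT : first ∈ₛ T
        linked   : Linked E (first ∷ suffix)
        avoids   : All (_∉ₛ T) suffix
        sameLast : lastOf first suffix ≡ lastOf x xs
        ⊆whole   : first ∷ suffix ⊆ x ∷ xs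
        unique   : Unique (x ∷ xs) → Unique (first ∷ suffix)

    lastHit : ∀ (T : Subset n) x xs → Linked E (x ∷ xs) → All (_∉ₛ T) (x ∷ xs) ⊎ LastHit T x xs
    lastHit T x [] l with x ∈? T
    ... | yes x∈T = inj₂ (lastHitAt x [] x∈T [-] [] refl (λ v∈ → v∈) (λ u → u))
    ... | no x∉T  = inj₁ (x∉T ∷ [])
    lastHit T x (y ∷ xs) (e ∷ l) with lastHit T y xs l
    ... | inj₂ (lastHitAt b zs b∈T l′ avoids sameLast ⊆whole unique) =
      inj₂ (lastHitAt b zs b∈T l′ avoids sameLast (there ∘ ⊆whole) (λ { (_ ∷ u) → unique u }))
    ... | inj₁ avoids with x ∈? T
    ...   | yes x∈T = inj₂ (lastHitAt x (y ∷ xs) x∈T (e ∷ l) avoids refl (λ v∈ → v∈) (λ u → u))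
    ...   | no x∉T  = inj₁ (x∉T ∷ avoids)

module _ {n : ℕ} where

  Arc : Set
  Arc = Fin n × Fin n

  ArcIn : List Arc → Fin n → Fin n → Set
  ArcIn G u v = (u , v) ∈ G

  arcsOf : List (Fin n) → List Arc
  arcsOf (x ∷ y ∷ xs) = (x , y) ∷ arcsOf (y ∷ xs)
  arcsOf _            = []

  linked-arcsOf : ∀ xs → Linked (ArcIn (arcsOf xs)) xs
  linked-arcsOf []           = []
  linked-arcsOf (x ∷ [])     = [-]
  linked-arcsOf (x ∷ y ∷ xs) = here refl ∷ Linked.map there (linked-arcsOf (y ∷ xs))

  arcsOf⇒Consec : ∀ {xs u v} → (u , v) ∈ arcsOf xs → Consec xs u v
  arcsOf⇒Consec {x ∷ y ∷ xs} (here refl) = inj₁ (refl , refl)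
  arcsOf⇒Consec {x ∷ y ∷ xs} (there uv∈) = inj₂ (arcsOf⇒Consec uv∈)

  Consec⇒∈ : ∀ {xs : List (Fin n)} {u v} → Consec xs u v → u ∈ xs × v ∈ xs
  Consec⇒∈ {x ∷ y ∷ xs} (inj₁ (refl , refl)) = here refl , there (here refl)
  Consec⇒∈ {x ∷ y ∷ xs} (inj₂ c) = let (u∈ , v∈) = Consec⇒∈ c in there u∈ , there v∈

  Consec-linked : ∀ {R : Fin n → Fin n → Set} {xs u v} → Linked R xs → Consec xs u v → R u v
  Consec-linked (e ∷ _) (inj₁ (refl , refl)) = e
  Consec-linked (_ ∷ l) (inj₂ c)             = Consec-linked l c

-- Finite subsets and disjoint families

module _ {n : ℕ} where
  open DecMembership (_≟ᶠ_ {n}) using () renaming (_∈?_ to _∈ˡ?_)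

  private
    All-∈-remove : ∀ {T : Subset n} {x} ys → All (_∈ₛ T) ys → x ∉ ys → All (_∈ₛ T - x) ys
    All-∈-remove []       _            _   = []
    All-∈-remove (y ∷ ys) (y∈T ∷ ys⊆T) x∉ =
      x∈p∧x≢y⇒x∈p-y y∈T (λ y≡x → x∉ (here (sym y≡x))) ∷ All-∈-remove ys ys⊆T (x∉ ∘ there)

  unique⇒length≤∣∣ : ∀ (T : Subset n) xs → Unique xs → All (_∈ₛ T) xs → length xs ≤ ∣ T ∣
  unique⇒length≤∣∣ T []       _          _            = z≤n
  unique⇒length≤∣∣ T (x ∷ xs) (x∉ ∷ u) (x∈T ∷ xs⊆T) =
    ≤-trans (s≤s (unique⇒length≤∣∣ (T - x) xs u (All-∈-remove xs xs⊆T (λ x∈ → All.lookup x∉ x∈ refl))))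
            (x∈p⇒∣p-x∣<∣p∣ x∈T)

  unique∧∣∣≤length⇒∈ : ∀ (T : Subset n) xs → Unique xs → All (_∈ₛ T) xs → ∣ T ∣ ≤ length xs →
    ∀ {s} → s ∈ₛ T → s ∈ xs
  unique∧∣∣≤length⇒∈ T xs u xs⊆T ∣T∣≤ {s} s∈T with s ∈ˡ? xs
  ... | yes s∈ = s∈
  ... | no s∉ = ⊥-elim (<-irrefl refl (begin-strict
      length xs     ≤⟨ unique⇒length≤∣∣ (T - s) xs u (All-∈-remove xs xs⊆T s∉) ⟩
      ∣ T - s ∣     <⟨ x∈p⇒∣p-x∣<∣p∣ s∈T ⟩
      ∣ T ∣         ≤⟨ ∣T∣≤ ⟩
      length xs     ∎))
    where open ≤-Reasoning

∣p∪q∣≤∣p∣+∣q∣ : ∀ {n} (p q : Subset n) → ∣ p ∪ q ∣ ≤ ∣ p ∣ + ∣ q ∣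
∣p∪q∣≤∣p∣+∣q∣ []            []            = z≤n
∣p∪q∣≤∣p∣+∣q∣ (inside ∷ p)  (inside ∷ q)  = s≤s (≤-trans (∣p∪q∣≤∣p∣+∣q∣ p q) (≤-trans (n≤1+n _) (≤-reflexive (sym (+-suc _ _)))))
∣p∪q∣≤∣p∣+∣q∣ (inside ∷ p)  (outside ∷ q) = s≤s (∣p∪q∣≤∣p∣+∣q∣ p q)
∣p∪q∣≤∣p∣+∣q∣ (outside ∷ p) (inside ∷ q)  = ≤-trans (s≤s (∣p∪q∣≤∣p∣+∣q∣ p q)) (≤-reflexive (sym (+-suc _ _)))
∣p∪q∣≤∣p∣+∣q∣ (outside ∷ p) (outside ∷ q) = ∣p∪q∣≤∣p∣+∣q∣ p q

elements : ∀ {n} → Subset n → List (Fin n)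
elements []            = []
elements (inside ∷ p)  = zero ∷ map fsuc (elements p)
elements (outside ∷ p) = map fsuc (elements p)

length-elements : ∀ {n} (p : Subset n) → length (elements p) ≡ ∣ p ∣
length-elements []            = refl
length-elements (inside ∷ p)  = cong suc (trans (length-map fsuc (elements p)) (length-elements p))
length-elements (outside ∷ p) = trans (length-map fsuc (elements p)) (length-elements p)

elements⊆ : ∀ {n} (p : Subset n) → All (_∈ₛ p) (elements p)
elements⊆ []            = []
elements⊆ (inside ∷ p)  = Vec.here ∷ All.map⁺ (All.map Vec.there (elements⊆ p))
elements⊆ (outside ∷ p) = All.map⁺ (All.map Vec.there (elements⊆ p))

elements-unique : ∀ {n} (p : Subset n) → Unique (elements p)
elements-unique []            = []
elements-unique (inside ∷ p)  = All.map⁺ (All.universal (λ _ ()) _) ∷ Unique.map⁺ fsuc-injective (elements-unique p)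
elements-unique (outside ∷ p) = Unique.map⁺ fsuc-injective (elements-unique p)

distinctElements : ∀ {n} (T : Subset n) k → k ≤ ∣ T ∣ →
  ∃[ xs ] length xs ≡ k × Unique xs × All (_∈ₛ T) xs
distinctElements T k k≤∣T∣ = take k (elements T) ,
  trans (length-take k (elements T)) (trans (cong (k ⊓_) (length-elements T)) (m≤n⇒m⊓n≡m k≤∣T∣)) ,
  Unique.take⁺ k (elements-unique T) , All.take⁺ k (elements⊆ T)

module _ {A B : Set} where

  length-mapWith∈ : ∀ (xs : List A) {f : ∀ {x} → x ∈ xs → B} → length (mapWith∈ xs f) ≡ length xs
  length-mapWith∈ = Membership.length-mapWith∈ (setoid A)
    where import Data.List.Membership.Setoid.Properties as Membership

  All-mapWith∈⁺ : ∀ {Q : B → Set} (xs : List A) (f : ∀ {x} → x ∈ xs → B) →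
    (∀ {x} (x∈ : x ∈ xs) → Q (f x∈)) → All Q (mapWith∈ xs f)
  All-mapWith∈⁺ []       f q = []
  All-mapWith∈⁺ (x ∷ xs) f q = q (here refl) ∷ All-mapWith∈⁺ xs (f ∘ there) (q ∘ there)

  AllPairs-mapWith∈⁺ : ∀ {R : A → A → Set} {S : B → B → Set} (xs : List A) (f : ∀ {x} → x ∈ xs → B) →
    (∀ {x y} (x∈ : x ∈ xs) (y∈ : y ∈ xs) → R x y → S (f x∈) (f y∈)) → AllPairs R xs → AllPairs S (mapWith∈ xs f)
  AllPairs-mapWith∈⁺ []       f s []         = []
  AllPairs-mapWith∈⁺ (x ∷ xs) f s (rs ∷ rss) =
    All-mapWith∈⁺ xs (f ∘ there) (λ y∈ → s (here refl) (there y∈) (All.lookup rs y∈)) ∷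
    AllPairs-mapWith∈⁺ xs (f ∘ there) (λ x∈ y∈ → s (there x∈) (there y∈)) rss

module PairwiseDisjoint {n : ℕ} {A : Set} (vertices : A → List (Fin n)) where

  Disjoint : A → A → Set
  Disjoint a b = ∀ v → v ∈ vertices a → ¬ v ∈ vertices b

  sharedVertex⇒≡ : ∀ {as a b v} → AllPairs Disjoint as → a ∈ as → b ∈ as → v ∈ vertices a → v ∈ vertices b → a ≡ b
  sharedVertex⇒≡ (_  ∷ _)  (here refl) (here refl) _  _  = refl
  sharedVertex⇒≡ (ds ∷ _)  (here refl) (there b∈)  va vb = ⊥-elim (All.lookup ds b∈ _ va vb)
  sharedVertex⇒≡ (ds ∷ _)  (there a∈)  (here refl) va vb = ⊥-elim (All.lookup ds a∈ _ vb va)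
  sharedVertex⇒≡ (_  ∷ dss) (there a∈) (there b∈)  va vb = sharedVertex⇒≡ dss a∈ b∈ va vb

  module Endpoints (endpoint : A → Fin n) (endpoint∈ : ∀ a → endpoint a ∈ vertices a) where

    endpoints-unique : ∀ {as} → AllPairs Disjoint as → Unique (map endpoint as)
    endpoints-unique ds = AllPairs.map⁺ (AllPairs.map
      (λ {a} {b} a#b e → a#b (endpoint a) (endpoint∈ a) (subst (_∈ vertices b) (sym e) (endpoint∈ b))) ds)

    Covers : List A → Subset n → Set
    Covers as T = ∀ {s} → s ∈ₛ T → ∃[ a ] a ∈ as × endpoint a ≡ s

    covers : ∀ {as} (T : Subset n) → AllPairs Disjoint as → All (λ a → endpoint a ∈ₛ T) as → ∣ T ∣ ≤ length as →
      Covers as T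
    covers {as} T ds ends∈T ∣T∣≤ s∈T
      with ∈-map⁻ endpoint (unique∧∣∣≤length⇒∈ T (map endpoint as) (endpoints-unique ds) (All.map⁺ ends∈T)
                              (≤-trans ∣T∣≤ (≤-reflexive (sym (length-map endpoint as)))) s∈T)
    ... | a , a∈ , s≡ = a , a∈ , sym s≡

    meetsOnlyAtEndpoint : ∀ {as T v a} → AllPairs Disjoint as → Covers as T → v ∈ₛ T → a ∈ as → v ∈ vertices a →
      v ≡ endpoint a
    meetsOnlyAtEndpoint ds cover v∈T a∈ v∈a with cover v∈T
    ... | b , b∈ , endpoint≡v with sharedVertex⇒≡ ds a∈ b∈ v∈a (subst (_∈ vertices b) endpoint≡v (endpoint∈ b))
    ...   | refl = sym endpoint≡v

module TwoPartFamily {n : ℕ} {T : Set} (part₁ part₂ : T → List (Fin n)) where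
  private
    module D₁ = PairwiseDisjoint part₁
    module D₂ = PairwiseDisjoint part₂

  Meets : Subset n → List (Fin n) → Set
  Meets Z vs = Any (_∈ₛ Z) vs

  meets-remove : ∀ {Z z vs ws} → z ∈ vs → (∀ v → v ∈ vs → ¬ v ∈ ws) → Meets Z ws → Meets (Z - z) ws
  meets-remove z∈vs vs#ws meets = let (u , u∈ws , u∈Z) = find meets in
    lose u∈ws (x∈p∧x≢y⇒x∈p-y u∈Z (λ { refl → vs#ws _ z∈vs u∈ws }))

  -- Each member met by Z uses up a vertex of Z₁ or of Z₂, and no vertex is used twice.
  meeting-bound : ∀ ts Z₁ Z₂ → AllPairs D₁.Disjoint ts → AllPairs D₂.Disjoint ts →
    All (λ t → Meets Z₁ (part₁ t) ⊎ Meets Z₂ (part₂ t)) ts → length ts ≤ ∣ Z₁ ∣ + ∣ Z₂ ∣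
  meeting-bound []       _  _  _           _           _                 = z≤n
  meeting-bound (t ∷ ts) Z₁ Z₂ (t#₁ ∷ ds₁) (_ ∷ ds₂) (inj₁ meets ∷ rest) =
    let (z , z∈ , z∈Z) = find meets in
    ≤-trans (s≤s (meeting-bound ts (Z₁ - z) Z₂ ds₁ ds₂
                   (All.zipWith (λ (m , t#u) → Data.Sum.map₁ (meets-remove z∈ t#u) m) (rest , t#₁))))
            (+-monoˡ-≤ ∣ Z₂ ∣ (x∈p⇒∣p-x∣<∣p∣ z∈Z))
  meeting-bound (t ∷ ts) Z₁ Z₂ (_ ∷ ds₁) (t#₂ ∷ ds₂) (inj₂ meets ∷ rest) =
    let (z , z∈ , z∈Z) = find meets in
    ≤-trans (s≤s (meeting-bound ts Z₁ (Z₂ - z) ds₁ ds₂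
                   (All.zipWith (λ (m , t#u) → Data.Sum.map₂ (meets-remove z∈ t#u) m) (rest , t#₂))))
            (≤-trans (≤-reflexive (sym (+-suc ∣ Z₁ ∣ _))) (+-monoʳ-≤ ∣ Z₁ ∣ (x∈p⇒∣p-x∣<∣p∣ z∈Z)))

  meets? : ∀ Z t → Dec (Meets Z (part₁ t) ⊎ Meets Z (part₂ t))
  meets? Z t = Any.any? (_∈? Z) (part₁ t) ⊎-dec Any.any? (_∈? Z) (part₂ t)

  missed : ∀ ts Z → AllPairs D₁.Disjoint ts → AllPairs D₂.Disjoint ts → ∣ Z ∣ + ∣ Z ∣ < length ts →
    ∃[ t ] t ∈ ts × All (_∉ₛ Z) (part₁ t) × All (_∉ₛ Z) (part₂ t)
  missed ts Z ds₁ ds₂ ∣Z∣+∣Z∣< with All.all? (meets? Z) ts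
  ... | yes allMet = ⊥-elim (<⇒≱ ∣Z∣+∣Z∣< (meeting-bound ts Z Z ds₁ ds₂ allMet))
  ... | no notAllMet with find (All.¬All⇒Any¬ (meets? Z) ts notAllMet)
  ...   | t , t∈ , unmet = t , t∈ , All.¬Any⇒All¬ (part₁ t) (unmet ∘ inj₁) , All.¬Any⇒All¬ (part₂ t) (unmet ∘ inj₂)

-- Menger's theorem

module _ {n : ℕ} where

  mapPath : ∀ {E E′ : Fin n → Fin n → Set} → (∀ {u v} → E u v → E′ u v) → Path E → Path E′
  mapPath f (mkPath x xs u l) = mkPath x xs u (Linked.map f l)

  trivialPath : ∀ {E : Fin n → Fin n → Set} → Fin n → Path E
  trivialPath v = mkPath v [] ([] ∷ []) [-]

  mapLinkage : ∀ {E E′ : Fin n → Fin n → Set} → (∀ {u v} → E u v → E′ u v) → Linkage E → Linkage E′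
  mapLinkage f L = mkLinkage (map (mapPath f) (Linkage.paths L)) (AllPairs.map⁺ (Linkage.disjoint L))

  LinkageOfOrder : ℕ → (Fin n → Fin n → Set) → Subset n → Subset n → Set
  LinkageOfOrder k E X Y = Σ (Linkage E) λ L → IsLinkageFromTo E X Y L × order E L ≡ k

  mapLinkageOfOrder : ∀ {k X Y} {E E′ : Fin n → Fin n → Set} → (∀ {u v} → E u v → E′ u v) →
    LinkageOfOrder k E X Y → LinkageOfOrder k E′ X Y
  mapLinkageOfOrder f (L , X→Y , ord) =
    mapLinkage f L , All.map⁺ X→Y , trans (length-map (mapPath f) (Linkage.paths L)) ord

  module _ {E E′ : Fin n → Fin n → Set} (f : ∀ {u v} → E u v → E′ u v) (L : Linkage E) where

    VertexOf-mapLinkage⁻ : ∀ {v} → VertexOf E′ (mapLinkage f L) v → VertexOf E L v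
    VertexOf-mapLinkage⁻ (p′ , p′∈ , v∈) with ∈-map⁻ (mapPath f) p′∈
    ... | p , p∈ , refl = p , p∈ , v∈

    ArcOf-mapLinkage⁻ : ∀ {u v} → ArcOf E′ (mapLinkage f L) u v → ArcOf E L u v
    ArcOf-mapLinkage⁻ (p′ , p′∈ , uv∈) with ∈-map⁻ (mapPath f) p′∈
    ... | p , p∈ , refl = p , p∈ , uv∈

    InStartEnd-mapLinkage⁺ : ∀ {v} → InStartEnd E L v → InStartEnd E′ (mapLinkage f L) v
    InStartEnd-mapLinkage⁺ (p , p∈ , v-end) = mapPath f p , ∈-map⁺ (mapPath f) p∈ , v-end

  AvoidingWalk : List Arc → Subset n → Subset n → Subset n → Set
  AvoidingWalk G X Y Z = ∃[ x ] ∃[ xs ]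
    Linked (ArcIn G) (x ∷ xs) × x ∈ₛ X × lastOf x xs ∈ₛ Y × All (_∉ₛ Z) (x ∷ xs)

  NoSeparatorBelow : ℕ → List Arc → Subset n → Subset n → Set
  NoSeparatorBelow k G X Y = ∀ Z → ∣ Z ∣ < k → AvoidingWalk G X Y Z

  linked-addArc : ∀ {e : Arc {n}} {G xs} → Linked (ArcIn G) xs → Linked (ArcIn (e ∷ G)) xs
  linked-addArc = Linked.map there

  beforeArc : ∀ {a b : Fin n} {G} x xs → Linked (ArcIn ((a , b) ∷ G)) (x ∷ xs) →
    Linked (ArcIn G) (x ∷ xs) ⊎ ∃[ ys ] Linked (ArcIn G) (x ∷ ys) × lastOf x ys ≡ a × x ∷ ys ⊆ x ∷ xs
  beforeArc x []       [-]             = inj₁ [-]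
  beforeArc x (y ∷ xs) (here ab≡ ∷ _)  = inj₂ ([] , [-] , cong proj₁ ab≡ , λ { (here refl) → here refl })
  beforeArc x (y ∷ xs) (there e ∷ l) with beforeArc y xs l
  ... | inj₁ l′ = inj₁ (e ∷ l′)
  ... | inj₂ (ys , l′ , last≡a , ⊆xs) =
    inj₂ (y ∷ ys , e ∷ l′ , last≡a , λ { (here refl) → here refl ; (there v∈) → there (⊆xs v∈) })

  afterArc : ∀ {a b : Fin n} {G} x xs → Linked (ArcIn ((a , b) ∷ G)) (x ∷ xs) →
    Linked (ArcIn G) (x ∷ xs) ⊎ ∃[ zs ] Linked (ArcIn G) (b ∷ zs) × lastOf b zs ≡ lastOf x xs × b ∷ zs ⊆ x ∷ xs
  afterArc x []       [-]     = inj₁ [-]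
  afterArc x (y ∷ xs) (e ∷ l) with afterArc y xs l
  ... | inj₂ (zs , l′ , sameLast , ⊆xs) = inj₂ (zs , l′ , sameLast , there ∘ ⊆xs)
  afterArc x (y ∷ xs) (here ab≡ ∷ l) | inj₁ l′ rewrite cong proj₂ ab≡ = inj₂ (xs , l′ , refl , there)
  afterArc x (y ∷ xs) (there e ∷ l)  | inj₁ l′ = inj₁ (e ∷ l′)

  -- A walk using the arc (a , b) splits into a walk ending in a and a walk starting in b.
  avoidingWalk? : ∀ G X Y Z → Dec (AvoidingWalk G X Y Z)
  avoidingWalk? [] X Y Z with any? (λ v → (v ∈? X) ×-dec ((v ∈? Y) ×-dec ¬? (v ∈? Z)))
  ... | yes (v , v∈X , v∈Y , v∉Z) = yes (v , [] , [-] , v∈X , v∈Y , v∉Z ∷ [])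
  ... | no none = no λ { (x , [] , [-] , x∈X , x∈Y , x∉Z ∷ []) → none (x , x∈X , x∈Y , x∉Z)
                        ; (x , y ∷ xs , (() ∷ _) , _) }
  avoidingWalk? ((a , b) ∷ G) X Y Z with avoidingWalk? G X Y Z
  ... | yes (x , xs , l , x∈X , last∈Y , avoids) = yes (x , xs , linked-addArc l , x∈X , last∈Y , avoids)
  ... | no noWalk with avoidingWalk? G X ⁅ a ⁆ Z | avoidingWalk? G ⁅ b ⁆ Y Z
  ...   | yes (x , xs , l , x∈X , last∈a , avoids) | yes (y , ys , l′ , y∈b , last∈Y , avoids′) =
    yes (x , xs ++ y ∷ ys ,
         linked-join xs (linked-addArc l) (here (cong₂ _,_ (x∈⁅y⁆⇒x≡y a last∈a) (x∈⁅y⁆⇒x≡y b y∈b)) ∷ linked-addArc l′) ,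
         x∈X , subst (_∈ₛ Y) (sym (lastOf-++ x xs (y ∷ ys))) last∈Y , All.++⁺ avoids avoids′)
  ...   | no noWalkToA | _ = no λ { (x , xs , l , x∈X , last∈Y , avoids) →
    [ (λ l′ → noWalk (x , xs , l′ , x∈X , last∈Y , avoids)) ,
      (λ { (ys , l′ , last≡a , ⊆xs) →
        noWalkToA (x , ys , l′ , x∈X , subst (_∈ₛ ⁅ a ⁆) (sym last≡a) (x∈⁅x⁆ a) , All.anti-mono ⊆xs avoids) }) ]
    (beforeArc x xs l) }
  ...   | yes _ | no noWalkFromB = no λ { (x , xs , l , x∈X , last∈Y , avoids) →
    [ (λ l′ → noWalk (x , xs , l′ , x∈X , last∈Y , avoids)) ,
      (λ { (zs , l′ , sameLast , ⊆xs) →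
        noWalkFromB (b , zs , l′ , x∈⁅x⁆ b , subst (_∈ₛ Y) (sym sameLast) last∈Y , All.anti-mono ⊆xs avoids) }) ]
    (afterArc x xs l) }

  ∉p∪⁅x⁆⇒≢ : ∀ {p : Subset n} {x v} → v ∉ₛ p ∪ ⁅ x ⁆ → v ≢ x
  ∉p∪⁅x⁆⇒≢ {x = x} v∉ refl = v∉ (x∈p∪q⁺ (inj₂ (x∈⁅x⁆ x)))

  ∉p∪q⇒∉p : ∀ {p q : Subset n} {v} → v ∉ₛ p ∪ q → v ∉ₛ p
  ∉p∪q⇒∉p v∉ v∈ = v∉ (x∈p∪q⁺ (inj₁ v∈))

-- The inductive step when deleting the arc (a , b) leaves a set S, ∣S∣ < k, separating X from Y.
-- Every X–Y walk of G⁺ meets S ∪ ⁅a⁆ before it uses (a , b) and meets S ∪ ⁅b⁆ after it, so by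
-- induction G has k disjoint paths from X to S ∪ ⁅a⁆ and k from S ∪ ⁅b⁆ to Y. Cut at their first
-- resp. last hit, paths of the two systems meet only at their ends in S, and the second system
-- covers S ∪ ⁅b⁆; gluing through S or along (a , b) gives k disjoint X–Y paths in G⁺.
module MengerStep {n : ℕ} (a b : Fin n) (G : List (Arc {n})) (k : ℕ) (X Y S : Subset n)
  (∣S∣<k : ∣ S ∣ < k) (S-separates : ¬ AvoidingWalk G X Y S)
  (unseparated : NoSeparatorBelow k ((a , b) ∷ G) X Y)
  (menger-G : ∀ X Y → NoSeparatorBelow k G X Y → LinkageOfOrder k (ArcIn G) X Y) where

  G⁺ : List Arc
  G⁺ = (a , b) ∷ G

  Sa Sb : Subset n
  Sa = S ∪ ⁅ a ⁆
  Sb = S ∪ ⁅ b ⁆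

  P : Set
  P = Path (ArcIn G)

  vs : P → List (Fin n)
  vs = verts (ArcIn G)

  st en : P → Fin n
  st = start (ArcIn G)
  en = end (ArcIn G)

  arcNotFromA : ∀ {u v} → u ≢ a × ArcIn G⁺ u v → ArcIn G u v
  arcNotFromA (u≢a , here refl) = ⊥-elim (u≢a refl)
  arcNotFromA (_   , there e)   = e

  arcNotIntoB : ∀ {u v} → v ≢ b × ArcIn G⁺ u v → ArcIn G u v
  arcNotIntoB (v≢b , here refl) = ⊥-elim (v≢b refl)
  arcNotIntoB (_   , there e)   = e

  b∉S : b ∉ₛ S
  b∉S b∈S with unseparated S ∣S∣<k
  ... | x , xs , l , x∈X , last∈Y , avoids = S-separates (x , xs ,
    Linked.map arcNotIntoB (linked-heads l (All.map (λ v∉S v≡b → v∉S (subst (_∈ₛ S) (sym v≡b) b∈S)) (All.tail avoids))) ,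
    x∈X , last∈Y , avoids)

  unseparated-X-Sa : NoSeparatorBelow k G X Sa
  unseparated-X-Sa Z ∣Z∣<k with unseparated Z ∣Z∣<k
  ... | x , xs , l , x∈X , last∈Y , avoids with firstHit Sa x xs l
  ...   | inj₁ avoidsSa = ⊥-elim (S-separates (x , xs ,
    Linked.map arcNotFromA (linked-tails l (All⇒AllButLast xs (All.map ∉p∪⁅x⁆⇒≢ avoidsSa))) ,
    x∈X , last∈Y , All.map ∉p∪q⇒∉p avoidsSa))
  ...   | inj₂ (firstHitAt ys l′ avoidsSa last∈Sa ⊆xs _ _) =
    x , ys , Linked.map arcNotFromA (linked-tails l′ (AllButLast-map ∉p∪⁅x⁆⇒≢ ys avoidsSa)) ,
    x∈X , last∈Sa , All.anti-mono ⊆xs avoids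

  unseparated-Sb-Y : NoSeparatorBelow k G Sb Y
  unseparated-Sb-Y Z ∣Z∣<k with unseparated Z ∣Z∣<k
  ... | x , xs , l , x∈X , last∈Y , avoids with lastHit Sb x xs l
  ...   | inj₁ avoidsSb = ⊥-elim (S-separates (x , xs ,
    Linked.map arcNotIntoB (linked-heads l (All.map ∉p∪⁅x⁆⇒≢ (All.tail avoidsSb))) ,
    x∈X , last∈Y , All.map ∉p∪q⇒∉p avoidsSb))
  ...   | inj₂ (lastHitAt c zs c∈Sb l′ avoidsSb sameLast ⊆xs _) =
    c , zs , Linked.map arcNotIntoB (linked-heads l′ (All.map ∉p∪⁅x⁆⇒≢ avoidsSb)) ,
    c∈Sb , subst (_∈ₛ Y) (sym sameLast) last∈Y , All.anti-mono ⊆xs avoids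

  record IntoSa : Set where
    field
      path    : P
      avoids  : AllButLast (_∉ₛ Sa) (Path.first path) (Path.rest path)
      end∈Sa  : en path ∈ₛ Sa
      start∈X : st path ∈ₛ X

  record OutOfSb : Set where
    field
      path     : P
      avoids   : All (_∉ₛ Sb) (Path.rest path)
      start∈Sb : st path ∈ₛ Sb
      end∈Y    : en path ∈ₛ Y

  trimIntoSa : (p : P) → st p ∈ₛ X → en p ∈ₛ Sa → Σ IntoSa λ t → vs (IntoSa.path t) ⊆ vs p
  trimIntoSa (mkPath x xs u l) x∈X last∈Sa with firstHit Sa x xs l
  ... | inj₁ avoidsSa = ⊥-elim (All.lookup avoidsSa (lastOf-∈ x xs) last∈Sa)
  ... | inj₂ (firstHitAt ys l′ avoidsSa last′∈Sa ⊆xs unique _) =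
    record { path = mkPath x ys (unique u) l′ ; avoids = avoidsSa ; end∈Sa = last′∈Sa ; start∈X = x∈X } , ⊆xs

  trimOutOfSb : (q : P) → st q ∈ₛ Sb → en q ∈ₛ Y → Σ OutOfSb λ t → vs (OutOfSb.path t) ⊆ vs q
  trimOutOfSb (mkPath x xs u l) x∈Sb last∈Y with lastHit Sb x xs l
  ... | inj₁ avoidsSb = ⊥-elim (All.lookup avoidsSb (here refl) x∈Sb)
  ... | inj₂ (lastHitAt c zs c∈Sb l′ avoidsSb sameLast ⊆xs unique) =
    record { path = mkPath c zs (unique u) l′ ; avoids = avoidsSb ; start∈Sb = c∈Sb
           ; end∈Y = subst (_∈ₛ Y) (sym sameLast) last∈Y } , ⊆xs

  open PairwiseDisjoint vs using (Disjoint)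
  private
    module Into = PairwiseDisjoint (vs ∘ IntoSa.path)
    module Out  = PairwiseDisjoint (vs ∘ OutOfSb.path)

  linkage₁ : LinkageOfOrder k (ArcIn G) X Sa
  linkage₁ = menger-G X Sa unseparated-X-Sa

  linkage₂ : LinkageOfOrder k (ArcIn G) Sb Y
  linkage₂ = menger-G Sb Y unseparated-Sb-Y

  paths₁ paths₂ : List P
  paths₁ = Linkage.paths (proj₁ linkage₁)
  paths₂ = Linkage.paths (proj₁ linkage₂)

  trimmed₁ : ∀ {p} → p ∈ paths₁ → Σ IntoSa λ t → vs (IntoSa.path t) ⊆ vs p
  trimmed₁ {p} p∈ = let (x∈X , last∈Sa) = All.lookup (proj₁ (proj₂ linkage₁)) p∈ in trimIntoSa p x∈X last∈Sa

  trimmed₂ : ∀ {q} → q ∈ paths₂ → Σ OutOfSb λ t → vs (OutOfSb.path t) ⊆ vs q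
  trimmed₂ {q} q∈ = let (x∈Sb , last∈Y) = All.lookup (proj₁ (proj₂ linkage₂)) q∈ in trimOutOfSb q x∈Sb last∈Y

  into : List IntoSa
  into = mapWith∈ paths₁ (proj₁ ∘ trimmed₁)

  out : List OutOfSb
  out = mapWith∈ paths₂ (proj₁ ∘ trimmed₂)

  length-into : length into ≡ k
  length-into = trans (length-mapWith∈ paths₁) (proj₂ (proj₂ linkage₁))

  length-out : length out ≡ k
  length-out = trans (length-mapWith∈ paths₂) (proj₂ (proj₂ linkage₂))

  into-disjoint : AllPairs Into.Disjoint into
  into-disjoint = AllPairs-mapWith∈⁺ paths₁ (proj₁ ∘ trimmed₁)
    (λ p∈ p′∈ p#p′ v v∈ v∈′ → p#p′ v (proj₂ (trimmed₁ p∈) v∈) (proj₂ (trimmed₁ p′∈) v∈′))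
    (Linkage.disjoint (proj₁ linkage₁))

  out-disjoint : AllPairs Out.Disjoint out
  out-disjoint = AllPairs-mapWith∈⁺ paths₂ (proj₁ ∘ trimmed₂)
    (λ q∈ q′∈ q#q′ v v∈ v∈′ → q#q′ v (proj₂ (trimmed₂ q∈) v∈) (proj₂ (trimmed₂ q′∈) v∈′))
    (Linkage.disjoint (proj₁ linkage₂))

  open Out.Endpoints (st ∘ OutOfSb.path) (λ _ → here refl) using (Covers; covers)

  out-covers-Sb : Covers out Sb
  out-covers-Sb = covers Sb out-disjoint (All-mapWith∈⁺ paths₂ _ (OutOfSb.start∈Sb ∘ proj₁ ∘ trimmed₂)) (begin
    ∣ S ∪ ⁅ b ⁆ ∣     ≤⟨ ∣p∪q∣≤∣p∣+∣q∣ S ⁅ b ⁆ ⟩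
    ∣ S ∣ + ∣ ⁅ b ⁆ ∣ ≡⟨ cong (∣ S ∣ +_) (∣⁅x⁆∣≡1 b) ⟩
    ∣ S ∣ + 1         ≡⟨ +-comm ∣ S ∣ 1 ⟩
    suc ∣ S ∣         ≤⟨ ∣S∣<k ⟩
    k                 ≡⟨ length-out ⟨
    length out        ∎)
    where open ≤-Reasoning

  -- A shared vertex outside S would give an S-avoiding X–Y walk through it.
  shared∈S : ∀ (t : IntoSa) (t′ : OutOfSb) {v} → v ∈ vs (IntoSa.path t) → v ∈ vs (OutOfSb.path t′) → v ∈ₛ S
  shared∈S t t′ {v} v∈p v∈q with v ∈? S
  ... | yes v∈S = v∈S
  ... | no v∉S with prefixUpTo (Path.first p) (Path.rest p) v∈p (Path.arcs p) (IntoSa.avoids t)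
                  | suffixFrom (Path.first q) (Path.rest q) v∈q (Path.arcs q) (OutOfSb.avoids t′)
    where p = IntoSa.path t
          q = OutOfSb.path t′
  ... | ys , l , last≡v , avoidsSa | zs , l′ , sameLast , avoidsSb = ⊥-elim (S-separates
    (Path.first (IntoSa.path t) , ys ++ zs ,
     linked-join ys l (subst (λ z → Linked (ArcIn G) (z ∷ zs)) (sym last≡v) l′) ,
     IntoSa.start∈X t ,
     subst (_∈ₛ Y) (sym (trans (lastOf-++ _ ys zs) (trans (cong (λ z → lastOf z zs) last≡v) sameLast))) (OutOfSb.end∈Y t′) ,
     All.++⁺ (AllButLast∧last⇒All ys (AllButLast-map ∉p∪q⇒∉p ys avoidsSa) (subst (_∉ₛ S) (sym last≡v) v∉S))
             (All.map ∉p∪q⇒∉p avoidsSb)))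

  shared⇒end≡start : ∀ (t : IntoSa) (t′ : OutOfSb) {v} → v ∈ vs (IntoSa.path t) → v ∈ vs (OutOfSb.path t′) →
    v ≡ en (IntoSa.path t) × v ≡ st (OutOfSb.path t′) × v ∈ₛ S
  shared⇒end≡start t t′ v∈p v∈q =
    AllButLast-avoids⇒≡last (Path.rest (IntoSa.path t)) (IntoSa.avoids t) v∈p (x∈p∪q⁺ (inj₁ v∈S)) ,
    All-avoids⇒≡first (Path.rest (OutOfSb.path t′)) (OutOfSb.avoids t′) v∈q (x∈p∪q⁺ (inj₁ v∈S)) ,
    v∈S
    where v∈S = shared∈S t t′ v∈p v∈q

  Continuation : IntoSa → Set
  Continuation t = Σ OutOfSb λ t′ → t′ ∈ out ×
    ((en p ∈ₛ S × st (OutOfSb.path t′) ≡ en p) ⊎ (en p ∉ₛ S × en p ≡ a × st (OutOfSb.path t′) ≡ b))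
    where p = IntoSa.path t

  continuation : (t : IntoSa) → Continuation t
  continuation t with en (IntoSa.path t) ∈? S
  ... | yes e∈S = let (t′ , t′∈ , start≡e) = out-covers-Sb (x∈p∪q⁺ (inj₁ e∈S)) in t′ , t′∈ , inj₁ (e∈S , start≡e)
  ... | no e∉S with x∈p∪q⁻ S ⁅ a ⁆ (IntoSa.end∈Sa t)
  ...   | inj₁ e∈S = ⊥-elim (e∉S e∈S)
  ...   | inj₂ e∈a = let (t′ , t′∈ , start≡b) = out-covers-Sb (x∈p∪q⁺ (inj₂ (x∈⁅x⁆ b)))
                     in t′ , t′∈ , inj₂ (e∉S , x∈⁅y⁆⇒x≡y a e∈a , start≡b)

  glue : (t : IntoSa) → Continuation t → Path (ArcIn G⁺)
  glue t (t′ , _ , inj₁ (_ , start≡end)) =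
    mkPath (Path.first p) (Path.rest p ++ Path.rest q)
      (Unique.++⁺ (Path.unique p) (tail-unique (Path.unique q))
         (λ (v∈p , v∈q) → let (_ , v≡start , _) = shared⇒end≡start t t′ v∈p (there v∈q) in
                           All.lookup (head-∉ (Path.unique q)) (subst (_∈ Path.rest q) v≡start v∈q) refl))
      (linked-join (Path.rest p) (linked-addArc (Path.arcs p))
         (subst (λ z → Linked (ArcIn G⁺) (z ∷ Path.rest q)) start≡end (linked-addArc (Path.arcs q))))
    where
    p = IntoSa.path t
    q = OutOfSb.path t′
    tail-unique : ∀ {x xs} → Unique (x ∷ xs) → Unique xs
    tail-unique (_ ∷ u) = u
    head-∉ : ∀ {x xs} → Unique (x ∷ xs) → All (x ≢_) xs
    head-∉ (x∉ ∷ _) = x∉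
  glue t (t′ , _ , inj₂ (end∉S , end≡a , start≡b)) =
    mkPath (Path.first p) (Path.rest p ++ vs q)
      (Unique.++⁺ (Path.unique p) (Path.unique q)
         (λ (v∈p , v∈q) → let (v≡end , _ , v∈S) = shared⇒end≡start t t′ v∈p v∈q in end∉S (subst (_∈ₛ S) v≡end v∈S)))
      (linked-join (Path.rest p) (linked-addArc (Path.arcs p)) (here (cong₂ _,_ end≡a start≡b) ∷ linked-addArc (Path.arcs q)))
    where
    p = IntoSa.path t
    q = OutOfSb.path t′

  glue-verts : ∀ t (c : Continuation t) {v} → v ∈ verts (ArcIn G⁺) (glue t c) →
    v ∈ vs (IntoSa.path t) ⊎ v ∈ vs (OutOfSb.path (proj₁ c))
  glue-verts t (_ , _ , inj₁ _) v∈ with ∈-++⁻ (vs (IntoSa.path t)) v∈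
  ... | inj₁ v∈p = inj₁ v∈p
  ... | inj₂ v∈q = inj₂ (there v∈q)
  glue-verts t (_ , _ , inj₂ _) v∈ = ∈-++⁻ (vs (IntoSa.path t)) v∈

  glue-start : ∀ t (c : Continuation t) → start (ArcIn G⁺) (glue t c) ≡ st (IntoSa.path t)
  glue-start t (_ , _ , inj₁ _) = refl
  glue-start t (_ , _ , inj₂ _) = refl

  glue-end : ∀ t (c : Continuation t) → end (ArcIn G⁺) (glue t c) ≡ en (OutOfSb.path (proj₁ c))
  glue-end t (t′ , _ , inj₁ (_ , start≡end)) =
    trans (lastOf-++ (Path.first p) (Path.rest p) (Path.rest q)) (cong (λ z → lastOf z (Path.rest q)) (sym start≡end))
    where p = IntoSa.path t
          q = OutOfSb.path t′
  glue-end t (t′ , _ , inj₂ _) = lastOf-++ (Path.first p) (Path.rest p) (vs (OutOfSb.path t′))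
    where p = IntoSa.path t

  ends-differ : ∀ t t′ → Into.Disjoint t t′ → en (IntoSa.path t) ≢ en (IntoSa.path t′)
  ends-differ t t′ t#t′ e≡e′ =
    t#t′ _ (lastOf-∈ _ _) (subst (_∈ vs (IntoSa.path t′)) (sym e≡e′) (lastOf-∈ _ _))

  into#continuation : ∀ t t′ (c′ : Continuation t′) → Into.Disjoint t t′ →
    ∀ {v} → v ∈ vs (IntoSa.path t) → ¬ v ∈ vs (OutOfSb.path (proj₁ c′))
  into#continuation t t′ (q , _ , inj₁ (_ , start≡end′)) t#t′ v∈p v∈q =
    let (v≡end , v≡start , _) = shared⇒end≡start t q v∈p v∈q in ends-differ t t′ t#t′ (trans (sym v≡end) (trans v≡start start≡end′))
  into#continuation t _ (q , _ , inj₂ (_ , _ , start≡b)) _ v∈p v∈q =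
    let (_ , v≡start , v∈S) = shared⇒end≡start t q v∈p v∈q in b∉S (subst (_∈ₛ S) (trans v≡start start≡b) v∈S)

  continuations-disjoint : ∀ t t′ (c : Continuation t) (c′ : Continuation t′) → Into.Disjoint t t′ →
    ∀ {v} → v ∈ vs (OutOfSb.path (proj₁ c)) → ¬ v ∈ vs (OutOfSb.path (proj₁ c′))
  continuations-disjoint t t′ (q , q∈ , kind) (q′ , q′∈ , kind′) t#t′ v∈q v∈q′
    with Out.sharedVertex⇒≡ out-disjoint q∈ q′∈ v∈q v∈q′
  ... | refl with kind | kind′
  ...   | inj₁ (_ , s≡e)      | inj₁ (_ , s≡e′)      = ends-differ t t′ t#t′ (trans (sym s≡e) s≡e′)
  ...   | inj₁ (e∈S , s≡e)    | inj₂ (_ , _ , s≡b)    = b∉S (subst (_∈ₛ S) (trans (sym s≡e) s≡b) e∈S)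
  ...   | inj₂ (_ , _ , s≡b)  | inj₁ (e∈S , s≡e)      = b∉S (subst (_∈ₛ S) (trans (sym s≡e) s≡b) e∈S)
  ...   | inj₂ (_ , e≡a , _)  | inj₂ (_ , e′≡a , _)   = ends-differ t t′ t#t′ (trans e≡a (sym e′≡a))

  glue-disjoint : ∀ {t t′} → Into.Disjoint t t′ →
    PairwiseDisjoint.Disjoint (verts (ArcIn G⁺)) (glue t (continuation t)) (glue t′ (continuation t′))
  glue-disjoint {t} {t′} t#t′ v v∈ v∈′ with glue-verts t (continuation t) v∈ | glue-verts t′ (continuation t′) v∈′
  ... | inj₁ v∈p | inj₁ v∈p′ = t#t′ v v∈p v∈p′
  ... | inj₁ v∈p | inj₂ v∈q′ = into#continuation t t′ (continuation t′) t#t′ v∈p v∈q′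
  ... | inj₂ v∈q | inj₁ v∈p′ = into#continuation t′ t (continuation t) (λ w w∈ w∈′ → t#t′ w w∈′ w∈) v∈p′ v∈q
  ... | inj₂ v∈q | inj₂ v∈q′ = continuations-disjoint t t′ (continuation t) (continuation t′) t#t′ v∈q v∈q′

  linkage : LinkageOfOrder k (ArcIn G⁺) X Y
  linkage = mkLinkage glued (AllPairs-mapWith∈⁺ into (λ {t} _ → glue t (continuation t)) (λ _ _ → glue-disjoint) into-disjoint) ,
    All-mapWith∈⁺ into _ (λ {t} _ → subst (_∈ₛ X) (sym (glue-start t (continuation t))) (IntoSa.start∈X t) ,
      subst (_∈ₛ Y) (sym (glue-end t (continuation t))) (OutOfSb.end∈Y (proj₁ (continuation t)))) ,
    trans (length-mapWith∈ into) length-into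
    where glued = mapWith∈ into (λ {t} _ → glue t (continuation t))

module _ {n : ℕ} where

  menger : ∀ (G : List (Arc {n})) k X Y → NoSeparatorBelow k G X Y → LinkageOfOrder k (ArcIn G) X Y
  menger [] k X Y unseparated with k ≤? ∣ X ∩ Y ∣
  ... | no k≰ = ⊥-elim (trivialWalk-avoids (unseparated (X ∩ Y) (≰⇒> k≰)))
    where
    trivialWalk-avoids : ¬ AvoidingWalk [] X Y (X ∩ Y)
    trivialWalk-avoids (x , [] , [-] , x∈X , x∈Y , x∉X∩Y ∷ []) = x∉X∩Y (x∈p∩q⁺ (x∈X , x∈Y))
  ... | yes k≤ = let (xs , length≡k , unique , xs⊆X∩Y) = distinctElements (X ∩ Y) k k≤ in
    mkLinkage (map trivialPath xs) (AllPairs.map⁺ (AllPairs.map (λ { x≢y v (here refl) (here refl) → x≢y refl }) unique)) ,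
    All.map⁺ (All.map (x∈p∩q⁻ X Y) xs⊆X∩Y) ,
    trans (length-map trivialPath xs) length≡k
  menger ((a , b) ∷ G) k X Y unseparated
    with anySubset? (λ Z → (suc ∣ Z ∣ ≤? k) ×-dec ¬? (avoidingWalk? G X Y Z))
  ... | no noSeparator = mapLinkageOfOrder there (menger G k X Y λ Z ∣Z∣<k →
    decidable-stable (avoidingWalk? G X Y Z) (λ noWalk → noSeparator (Z , ∣Z∣<k , noWalk)))
  ... | yes (S , ∣S∣<k , S-separates) = MengerStep.linkage a b G k X Y S ∣S∣<k S-separates unseparated (menger G k)

-- Systems of W disjoint walks

module Routing {n : ℕ} (E : Fin n → Fin n → Set) (W : ℕ) where

  record Walk : Set where
    constructor mkWalk
    field
      first : Fin n
      rest  : List (Fin n)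
      arcs  : Linked E (first ∷ rest)

  vertices : Walk → List (Fin n)
  vertices f = Walk.first f ∷ Walk.rest f

  source target : Walk → Fin n
  source = Walk.first
  target f = lastOf (Walk.first f) (Walk.rest f)

  target∈ : ∀ f → target f ∈ vertices f
  target∈ f = lastOf-∈ (Walk.first f) (Walk.rest f)

  pathWalk : Path E → Walk
  pathWalk p = mkWalk (Path.first p) (Path.rest p) (Path.arcs p)

  open PairwiseDisjoint vertices public using (Disjoint; sharedVertex⇒≡)

  record Routing (X Y : Subset n) (Region : Fin n → Set) : Set where
    field
      walks    : List Walk
      count    : length walks ≡ W
      disjoint : AllPairs Disjoint walks
      sources  : All (λ f → source f ∈ₛ X) walks
      targets  : All (λ f → target f ∈ₛ Y) walks
      within   : All (λ f → All Region (vertices f)) walks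

  module _ {X Y : Subset n} {Region : Fin n → Set} (H : Routing X Y Region) where
    open Routing H
    private
      module Sources = PairwiseDisjoint.Endpoints vertices source (λ _ → here refl)
      module Targets = PairwiseDisjoint.Endpoints vertices target target∈

    sources-cover : ∣ X ∣ ≡ W → Sources.Covers walks X
    sources-cover ∣X∣≡W = Sources.covers X disjoint sources (≤-reflexive (trans ∣X∣≡W (sym count)))

    targets-cover : ∣ Y ∣ ≡ W → Targets.Covers walks Y
    targets-cover ∣Y∣≡W = Targets.covers Y disjoint targets (≤-reflexive (trans ∣Y∣≡W (sym count)))

    meetsSourcesOnlyAtSource : ∣ X ∣ ≡ W → ∀ {v f} → v ∈ₛ X → f ∈ walks → v ∈ vertices f → v ≡ source f
    meetsSourcesOnlyAtSource ∣X∣≡W = Sources.meetsOnlyAtEndpoint disjoint (sources-cover ∣X∣≡W)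

    meetsTargetsOnlyAtTarget : ∣ Y ∣ ≡ W → ∀ {v f} → v ∈ₛ Y → f ∈ walks → v ∈ vertices f → v ≡ target f
    meetsTargetsOnlyAtTarget ∣Y∣≡W = Targets.meetsOnlyAtEndpoint disjoint (targets-cover ∣Y∣≡W)

  enlargeRegion : ∀ {X Y} {Region Region′ : Fin n → Set} → (∀ {v} → Region v → Region′ v) →
    Routing X Y Region → Routing X Y Region′
  enlargeRegion f H = record { walks = walks ; count = count ; disjoint = disjoint ; sources = sources
                             ; targets = targets ; within = All.map (All.map f) within }
    where open Routing H

  concatWalk : (f g : Walk) → source g ≡ target f → Walk
  concatWalk f g g≡f = mkWalk (Walk.first f) (Walk.rest f ++ Walk.rest g)
    (linked-join (Walk.rest f) (Walk.arcs f) (subst (λ z → Linked E (z ∷ Walk.rest g)) g≡f (Walk.arcs g)))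

  target-concatWalk : ∀ f g g≡f → target (concatWalk f g g≡f) ≡ target g
  target-concatWalk f g g≡f =
    trans (lastOf-++ (Walk.first f) (Walk.rest f) (Walk.rest g)) (cong (λ z → lastOf z (Walk.rest g)) (sym g≡f))

  vertices-concatWalk : ∀ f g g≡f {v} → v ∈ vertices (concatWalk f g g≡f) → v ∈ vertices f ⊎ v ∈ vertices g
  vertices-concatWalk f g g≡f v∈ with ∈-++⁻ (vertices f) v∈
  ... | inj₁ v∈f = inj₁ v∈f
  ... | inj₂ v∈g = inj₂ (there v∈g)

  -- The W targets of H₁ are distinct vertices of Y and ∣Y∣ = W, so every vertex of Y starts a walk
  -- of H₂; as the regions meet only in Y, a walk of H₁ meets a walk of H₂ at most in its target.
  module Composition {X Y Z : Subset n} {Region₁ Region₂ : Fin n → Set}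
    (H₁ : Routing X Y Region₁) (H₂ : Routing Y Z Region₂) (∣Y∣≡W : ∣ Y ∣ ≡ W)
    (regions-meet-in-Y : ∀ {v} → Region₁ v → Region₂ v → v ∈ₛ Y) where

    private
      module H₁ = Routing H₁
      module H₂ = Routing H₂

    Successor : Walk → Set
    Successor f = Σ Walk λ g → g ∈ H₂.walks × source g ≡ target f

    successor : ∀ {f} → f ∈ H₁.walks → Successor f
    successor f∈ = sources-cover H₂ ∣Y∣≡W (All.lookup H₁.targets f∈)

    extend : ∀ f → Successor f → Walk
    extend f (g , _ , g≡f) = concatWalk f g g≡f

    shared⇒target≡source : ∀ {f g v} → f ∈ H₁.walks → g ∈ H₂.walks → v ∈ vertices f → v ∈ vertices g →
      v ≡ target f × v ≡ source g
    shared⇒target≡source f∈ g∈ v∈f v∈g =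
      meetsTargetsOnlyAtTarget H₁ ∣Y∣≡W v∈Y f∈ v∈f , meetsSourcesOnlyAtSource H₂ ∣Y∣≡W v∈Y g∈ v∈g
      where v∈Y = regions-meet-in-Y (All.lookup (All.lookup H₁.within f∈) v∈f) (All.lookup (All.lookup H₂.within g∈) v∈g)

    targets-differ : ∀ f f′ → Disjoint f f′ → target f ≢ target f′
    targets-differ f f′ f#f′ t≡t′ = f#f′ _ (target∈ f) (subst (_∈ vertices f′) (sym t≡t′) (target∈ f′))

    extend-disjoint : ∀ {f f′} → f ∈ H₁.walks → f′ ∈ H₁.walks → (s : Successor f) (s′ : Successor f′) →
      Disjoint f f′ → Disjoint (extend f s) (extend f′ s′)
    extend-disjoint {f} {f′} f∈ f′∈ (g , g∈ , g≡f) (g′ , g′∈ , g′≡f′) f#f′ v v∈ v∈′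
      with vertices-concatWalk f g g≡f v∈ | vertices-concatWalk f′ g′ g′≡f′ v∈′
    ... | inj₁ v∈f | inj₁ v∈f′ = f#f′ v v∈f v∈f′
    ... | inj₁ v∈f | inj₂ v∈g′ = let (v≡t , v≡s′) = shared⇒target≡source f∈ g′∈ v∈f v∈g′ in
      targets-differ f f′ f#f′ (trans (sym v≡t) (trans v≡s′ g′≡f′))
    ... | inj₂ v∈g | inj₁ v∈f′ = let (v≡t′ , v≡s) = shared⇒target≡source f′∈ g∈ v∈f′ v∈g in
      targets-differ f f′ f#f′ (trans (sym g≡f) (trans (sym v≡s) v≡t′))
    ... | inj₂ v∈g | inj₂ v∈g′ with sharedVertex⇒≡ H₂.disjoint g∈ g′∈ v∈g v∈g′
    ...   | refl = targets-differ f f′ f#f′ (trans (sym g≡f) g′≡f′)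

    extend-within : ∀ {f} → f ∈ H₁.walks → (s : Successor f) → All (λ v → Region₁ v ⊎ Region₂ v) (vertices (extend f s))
    extend-within {f} f∈ (g , g∈ , g≡f) = All.tabulate λ v∈ → [ inj₁ ∘ All.lookup (All.lookup H₁.within f∈)
                                                              , inj₂ ∘ All.lookup (All.lookup H₂.within g∈) ]
                                                              (vertices-concatWalk f g g≡f v∈)

    composed : Routing X Z (λ v → Region₁ v ⊎ Region₂ v)
    composed = record
      { walks    = mapWith∈ H₁.walks extended
      ; count    = trans (length-mapWith∈ H₁.walks) H₁.count
      ; disjoint = AllPairs-mapWith∈⁺ H₁.walks extended
                     (λ f∈ f′∈ → extend-disjoint f∈ f′∈ (successor f∈) (successor f′∈)) H₁.disjoint
      ; sources  = All-mapWith∈⁺ H₁.walks extended (All.lookup H₁.sources)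
      ; targets  = All-mapWith∈⁺ H₁.walks extended λ {f} f∈ → let (g , g∈ , g≡f) = successor f∈ in
                     subst (_∈ₛ Z) (sym (target-concatWalk f g g≡f)) (All.lookup H₂.targets g∈)
      ; within   = All-mapWith∈⁺ H₁.walks extended (λ f∈ → extend-within f∈ (successor f∈))
      }
      where
      extended : ∀ {f} → f ∈ H₁.walks → Walk
      extended {f} f∈ = extend f (successor f∈)

  compose : ∀ {X Y Z} {Region₁ Region₂ : Fin n → Set} → Routing X Y Region₁ → Routing Y Z Region₂ → ∣ Y ∣ ≡ W →
    (∀ {v} → Region₁ v → Region₂ v → v ∈ₛ Y) → Routing X Z (λ v → Region₁ v ⊎ Region₂ v)
  compose H₁ H₂ ∣Y∣≡W meet = Composition.composed H₁ H₂ ∣Y∣≡W meet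

  identityRouting : ∀ X → ∣ X ∣ ≡ W → Routing X X (_∈ₛ X)
  identityRouting X ∣X∣≡W = let (xs , length≡W , unique , xs⊆X) = distinctElements X W (≤-reflexive (sym ∣X∣≡W)) in
    record
      { walks    = map trivialWalk xs
      ; count    = trans (length-map trivialWalk xs) length≡W
      ; disjoint = AllPairs.map⁺ (AllPairs.map (λ { x≢y v (here refl) (here refl) → x≢y refl }) unique)
      ; sources  = All.map⁺ xs⊆X
      ; targets  = All.map⁺ xs⊆X
      ; within   = All.map⁺ (All.map (_∷ []) xs⊆X)
      }
    where
    trivialWalk : Fin n → Walk
    trivialWalk v = mkWalk v [] [-]

  linkageRouting : ∀ {X Y} (L : Linkage E) → IsLinkageFromTo E X Y L → order E L ≡ W → Routing X Y (VertexOf E L)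
  linkageRouting L X→Y order≡W = record
    { walks    = map pathWalk (Linkage.paths L)
    ; count    = trans (length-map pathWalk (Linkage.paths L)) order≡W
    ; disjoint = AllPairs.map⁺ (Linkage.disjoint L)
    ; sources  = All.map⁺ (All.map proj₁ X→Y)
    ; targets  = All.map⁺ (All.map proj₂ X→Y)
    ; within   = All.map⁺ (All.tabulate (λ {p} p∈ → All.tabulate (λ v∈ → p , p∈ , v∈)))
    }

-- Paths of well-linked sets

odd≢even : ∀ a b → suc (a * 2) ≢ b * 2
odd≢even a b odd≡even = 1≢0 (begin
  1               ≡⟨ [m+kn]%n≡m%n 1 a 2 ⟨
  suc (a * 2) % 2 ≡⟨ cong (_% 2) odd≡even ⟩
  b * 2 % 2       ≡⟨ m*n%n≡0 b 2 ⟩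
  0               ∎)
  where
  open ≡-Reasoning
  1≢0 : 1 ≢ 0
  1≢0 ()

module WellLinkedPath {n : ℕ} (E : Fin n → Fin n → Set) {W ℓ : ℕ} (SP : PathOfWellLinkedSets E W ℓ) where
  open PathOfWellLinkedSets SP
  open Routing E W

  data Piece : Set where
    cluster : Fin (suc ℓ) → Piece
    link    : Fin ℓ → Piece

  -- the position of a piece along S₀, P₀, S₁, P₁, …, P_{ℓ-1}, Sℓ
  rank : Piece → ℕ
  rank (cluster m) = toℕ m * 2
  rank (link k)    = suc (toℕ k * 2)

  _∋_ : Piece → Fin n → Set
  cluster m ∋ v = v ∈ₛ Subgraph.vs (S m)
  link k    ∋ v = VertexOf E (P k) v

  entry exit : Piece → Subset n
  entry (cluster m) = A m
  entry (link k)    = B (inject₁ k)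
  exit (cluster m)  = B m
  exit (link k)     = A (fsuc k)

  rank-cluster-inject₁ : ∀ k → rank (cluster (inject₁ k)) ≡ toℕ k * 2
  rank-cluster-inject₁ k = cong (_* 2) (toℕ-inject₁ k)

  cluster<link : ∀ k → rank (cluster (inject₁ k)) < rank (link k)
  cluster<link k = s≤s (≤-reflexive (rank-cluster-inject₁ k))

  link<cluster : ∀ k → rank (link k) < rank (cluster (fsuc k))
  link<cluster k = ≤-refl

  rank≡⇒cluster : ∀ {π m} → rank π ≡ rank (cluster m) → π ≡ cluster m
  rank≡⇒cluster {cluster m′} {m} r≡ = cong cluster (toℕ-injective (*-cancelʳ-≡ (toℕ m′) (toℕ m) 2 r≡))
  rank≡⇒cluster {link k}     {m} r≡ = ⊥-elim (odd≢even (toℕ k) (toℕ m) r≡)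

  inject₁≢fsuc : ∀ (k : Fin ℓ) → inject₁ k ≢ fsuc k
  inject₁≢fsuc k eq = <-irrefl (cong toℕ eq) (s≤s (≤-reflexive (toℕ-inject₁ k)))

  start∈B : ∀ {k p} → p ∈ Linkage.paths (P k) → start E p ∈ₛ B (inject₁ k)
  start∈B {k} p∈ = proj₁ (All.lookup (P-linkage k) p∈)

  end∈A : ∀ {k p} → p ∈ Linkage.paths (P k) → end E p ∈ₛ A (fsuc k)
  end∈A {k} p∈ = proj₂ (All.lookup (P-linkage k) p∈)

  crossing : ∀ {π π′ v} → π ∋ v → π′ ∋ v → rank π < rank π′ →
    v ∈ₛ exit π × v ∈ₛ entry π′ × rank π′ ≡ suc (rank π)
  crossing {cluster m} {cluster m′} v∈ v∈′ r< = ⊥-elim (clusters-disjoint m m′ (λ { refl → <-irrefl refl r< }) _ v∈ v∈′)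
  crossing {link k}    {link k′}    v∈ v∈′ r< = ⊥-elim (P-disjoint k k′ (λ { refl → <-irrefl refl r< }) _ v∈ v∈′)
  crossing {cluster m} {link k} {v} v∈ (p , p∈ , v∈p) r< with m ≟ᶠ inject₁ k | m ≟ᶠ fsuc k
  ... | yes refl | _ with P-int-disj-left k p p∈ v v∈p v∈
  ...   | inj₁ start≡v = v∈B , v∈B , cong suc (sym (rank-cluster-inject₁ k))
    where v∈B = subst (_∈ₛ B (inject₁ k)) start≡v (start∈B p∈)
  ...   | inj₂ end≡v = ⊥-elim (clusters-disjoint (inject₁ k) (fsuc k) (inject₁≢fsuc k) v v∈
                                 (A⊆S (fsuc k) (subst (_∈ₛ A (fsuc k)) end≡v (end∈A p∈))))
  crossing {cluster m} {link k} v∈ (p , p∈ , v∈p) r< | no _ | yes refl = ⊥-elim (<-asym r< (link<cluster k))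
  crossing {cluster m} {link k} {v} v∈ (p , p∈ , v∈p) r< | no m≢ | no m≢′ = ⊥-elim (P-disj-others k m m≢ m≢′ v (p , p∈ , v∈p) v∈)
  crossing {link k} {cluster m} {v} (p , p∈ , v∈p) v∈ r< with m ≟ᶠ fsuc k | m ≟ᶠ inject₁ k
  ... | yes refl | _ with P-int-disj-right k p p∈ v v∈p v∈
  ...   | inj₂ end≡v = v∈A , v∈A , refl
    where v∈A = subst (_∈ₛ A (fsuc k)) end≡v (end∈A p∈)
  ...   | inj₁ start≡v = ⊥-elim (clusters-disjoint (inject₁ k) (fsuc k) (inject₁≢fsuc k) v
                                   (B⊆S (inject₁ k) (subst (_∈ₛ B (inject₁ k)) start≡v (start∈B p∈))) v∈)
  crossing {link k} {cluster m} (p , p∈ , v∈p) v∈ r< | no _ | yes refl = ⊥-elim (<-asym r< (cluster<link k))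
  crossing {link k} {cluster m} {v} (p , p∈ , v∈p) v∈ r< | no m≢′ | no m≢ = ⊥-elim (P-disj-others k m m≢ m≢′ v (p , p∈ , v∈p) v∈)

  exits : ∀ {π π′ v} → π ∋ v → π′ ∋ v → rank π < rank π′ → v ∈ₛ exit π
  exits v∈ v∈′ r< = proj₁ (crossing v∈ v∈′ r<)

  enters : ∀ {π π′ v} → π ∋ v → π′ ∋ v → rank π < rank π′ → v ∈ₛ entry π′
  enters v∈ v∈′ r< = proj₁ (proj₂ (crossing v∈ v∈′ r<))

  adjacent : ∀ {π π′ v} → π ∋ v → π′ ∋ v → rank π < rank π′ → rank π′ ≡ suc (rank π)
  adjacent v∈ v∈′ r< = proj₂ (proj₂ (crossing v∈ v∈′ r<))

  Below Above : ℕ → Fin n → Set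
  Below r v = ∃[ π ] π ∋ v × rank π < r
  Above r v = ∃[ π ] π ∋ v × r < rank π

  LeftOf RightOf : Fin (suc ℓ) → Fin n → Set
  LeftOf m v  = v ∈ₛ A m ⊎ Below (rank (cluster m)) v
  RightOf m v = v ∈ₛ B m ⊎ Above (rank (cluster m)) v

  clusterRouting : ∀ m → Routing (A m) (B m) (cluster m ∋_)
  clusterRouting m with wellLinked m (A m) (B m) (λ v∈ → v∈) (λ v∈ → v∈) (trans (∣A∣ m) (sym (∣B∣ m)))
  ... | L , A→B , (inCluster , _) , order≡ =
    enlargeRegion (inCluster _) (linkageRouting L A→B (trans order≡ (∣A∣ m)))

  linkRouting : ∀ k → Routing (B (inject₁ k)) (A (fsuc k)) (link k ∋_)
  linkRouting k = linkageRouting (P k) (P-linkage k) (P-order k)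

  opaque
    leftward : ∀ m → Routing (A zero) (A m) (LeftOf m)
    leftward = <-weakInduction (λ m → Routing (A zero) (A m) (LeftOf m))
      (enlargeRegion inj₁ (identityRouting (A zero) (∣A∣ zero)))
      (λ k H → enlargeRegion (widen k)
         (compose (compose H (clusterRouting (inject₁ k)) (∣A∣ _) (arrive k)) (linkRouting k) (∣B∣ _) (leave k)))
      where
      arrive : ∀ k {v} → LeftOf (inject₁ k) v → cluster (inject₁ k) ∋ v → v ∈ₛ A (inject₁ k)
      arrive k (inj₁ v∈A)           _  = v∈A
      arrive k (inj₂ (π , v∈π , r<)) v∈ = enters v∈π v∈ r<

      leave : ∀ k {v} → LeftOf (inject₁ k) v ⊎ cluster (inject₁ k) ∋ v → link k ∋ v → v ∈ₛ B (inject₁ k)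
      leave k (inj₁ (inj₁ v∈A))           v∈ = enters (A⊆S (inject₁ k) v∈A) v∈ (cluster<link k)
      leave k (inj₁ (inj₂ (π , v∈π , r<))) v∈ = enters v∈π v∈ (<-trans r< (cluster<link k))
      leave k (inj₂ v∈c)                  v∈ = enters v∈c v∈ (cluster<link k)

      widen : ∀ k {v} → (LeftOf (inject₁ k) v ⊎ cluster (inject₁ k) ∋ v) ⊎ link k ∋ v → LeftOf (fsuc k) v
      widen k (inj₁ (inj₁ (inj₁ v∈A)))         = inj₂ (_ , A⊆S (inject₁ k) v∈A , <-trans (cluster<link k) (link<cluster k))
      widen k (inj₁ (inj₁ (inj₂ (π , v∈π , r<)))) = inj₂ (π , v∈π , <-trans r< (<-trans (cluster<link k) (link<cluster k)))
      widen k (inj₁ (inj₂ v∈c))                = inj₂ (_ , v∈c , <-trans (cluster<link k) (link<cluster k))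
      widen k (inj₂ v∈l)                       = inj₂ (_ , v∈l , link<cluster k)

    rightward : ∀ m → Routing (B m) (B (fromℕ ℓ)) (RightOf m)
    rightward = >-weakInduction (λ m → Routing (B m) (B (fromℕ ℓ)) (RightOf m))
      (enlargeRegion inj₁ (identityRouting (B (fromℕ ℓ)) (∣B∣ _)))
      (λ k H → enlargeRegion (widen k)
         (compose (compose (linkRouting k) (clusterRouting (fsuc k)) (∣A∣ _) (arrive k)) H (∣B∣ _) (leave k)))
      where
      arrive : ∀ k {v} → link k ∋ v → cluster (fsuc k) ∋ v → v ∈ₛ A (fsuc k)
      arrive k v∈l v∈c = enters v∈l v∈c (link<cluster k)

      leave : ∀ k {v} → link k ∋ v ⊎ cluster (fsuc k) ∋ v → RightOf (fsuc k) v → v ∈ₛ B (fsuc k)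
      leave k _         (inj₁ v∈B)            = v∈B
      leave k (inj₂ v∈c) (inj₂ (π , v∈π , r<)) = exits v∈c v∈π r<
      leave k (inj₁ v∈l) (inj₂ (π , v∈π , r<)) =
        ⊥-elim (<-irrefl (sym (adjacent v∈l v∈π (<-trans (link<cluster k) r<))) r<)

      widen : ∀ k {v} → (link k ∋ v ⊎ cluster (fsuc k) ∋ v) ⊎ RightOf (fsuc k) v → RightOf (inject₁ k) v
      widen k (inj₁ (inj₁ v∈l))            = inj₂ (_ , v∈l , cluster<link k)
      widen k (inj₁ (inj₂ v∈c))            = inj₂ (_ , v∈c , <-trans (cluster<link k) (link<cluster k))
      widen k (inj₂ (inj₁ v∈B))            = inj₂ (_ , B⊆S (fsuc k) v∈B , <-trans (cluster<link k) (link<cluster k))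
      widen k (inj₂ (inj₂ (π , v∈π , r<))) = inj₂ (π , v∈π , <-trans (<-trans (cluster<link k) (link<cluster k)) r<)

  Between : Fin (suc ℓ) → Fin (suc ℓ) → Fin n → Set
  Between i j v = ∃[ π ] π ∋ v × rank (cluster i) ≤ rank π × rank π ≤ rank (cluster j)

  SubVertex⇒Between : ∀ {i j v} → SubVertex E SP i j v → Between i j v
  SubVertex⇒Between (inj₁ (m , i≤m , m≤j , v∈)) = cluster m , v∈ , *-monoˡ-≤ 2 i≤m , *-monoˡ-≤ 2 m≤j
  SubVertex⇒Between (inj₂ (k , i≤k , k<j , v∈)) = link k , v∈ , m≤n⇒m≤1+n (*-monoˡ-≤ 2 i≤k) , <⇒≤ (*-monoˡ-≤ 2 k<j)

  SubArc⇒SubVertex : ∀ {i j u v} → SubArc E SP i j u v → SubVertex E SP i j u × SubVertex E SP i j v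
  SubArc⇒SubVertex (inj₁ (m , i≤m , m≤j , uv∈)) =
    let (u∈ , v∈) = Subgraph.as-ends (S m) uv∈ in inj₁ (m , i≤m , m≤j , u∈) , inj₁ (m , i≤m , m≤j , v∈)
  SubArc⇒SubVertex (inj₂ (k , i≤k , k<j , (p , p∈ , c))) =
    let (u∈ , v∈) = Consec⇒∈ c in inj₂ (k , i≤k , k<j , (p , p∈ , u∈)) , inj₂ (k , i≤k , k<j , (p , p∈ , v∈))

  RightOf∩Between⊆B : ∀ {i j v} → RightOf j v → Between i j v → v ∈ₛ B j
  RightOf∩Between⊆B (inj₁ v∈B) _ = v∈B
  RightOf∩Between⊆B {j = j} (inj₂ (π , v∈π , j<π)) (π′ , v∈π′ , _ , π′≤j)
    with rank≡⇒cluster {π′} {j} (≤-antisym π′≤j (s≤s⁻¹ (subst (rank (cluster j) <_) (adjacent v∈π′ v∈π π′<π) j<π)))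
    where π′<π = <-≤-trans (s≤s π′≤j) j<π
  ... | refl = exits v∈π′ v∈π (<-≤-trans (s≤s π′≤j) j<π)

  LeftOf∩Between⊆A : ∀ {i j v} → LeftOf i v → Between i j v → v ∈ₛ A i
  LeftOf∩Between⊆A (inj₁ v∈A) _ = v∈A
  LeftOf∩Between⊆A {i = i} (inj₂ (π , v∈π , π<i)) (π′ , v∈π′ , i≤π′ , _)
    with rank≡⇒cluster {π′} {i} (≤-antisym (subst (_≤ rank (cluster i)) (sym (adjacent v∈π v∈π′ π<π′)) π<i) i≤π′)
    where π<π′ = <-≤-trans π<i i≤π′
  ... | refl = enters v∈π v∈π′ (<-≤-trans π<i i≤π′)

  RightOf∩LeftOf≡∅ : ∀ {i j v} → toℕ i ≤ toℕ j → RightOf j v → LeftOf i v → ⊥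
  RightOf∩LeftOf≡∅ {i} {j} {v} i≤j (inj₁ v∈B) (inj₁ v∈A) with i ≟ᶠ j
  ... | yes refl = A∩B i v v∈A v∈B
  ... | no i≢j  = clusters-disjoint i j i≢j v (A⊆S i v∈A) (B⊆S j v∈B)
  RightOf∩LeftOf≡∅ {j = j} i≤j (inj₁ v∈B) (inj₂ (π , v∈π , π<i)) =
    A∩B j _ (enters v∈π (B⊆S j v∈B) (<-≤-trans π<i (*-monoˡ-≤ 2 i≤j))) v∈B
  RightOf∩LeftOf≡∅ {i = i} i≤j (inj₂ (π , v∈π , j<π)) (inj₁ v∈A) =
    A∩B i _ v∈A (exits (A⊆S i v∈A) v∈π (≤-<-trans (*-monoˡ-≤ 2 i≤j) j<π))
  RightOf∩LeftOf≡∅ {i} {j} i≤j (inj₂ (π , v∈π , j<π)) (inj₂ (π′ , v∈π′ , π′<i)) =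
    <-irrefl refl (begin-strict
      rank π           ≡⟨ adjacent v∈π′ v∈π π′<π ⟩
      suc (rank π′)    ≤⟨ π′<i ⟩
      rank (cluster i) ≤⟨ *-monoˡ-≤ 2 i≤j ⟩
      rank (cluster j) <⟨ j<π ⟩
      rank π           ∎)
    where
    open ≤-Reasoning
    π′<π = <-trans π′<i (≤-<-trans (*-monoˡ-≤ 2 i≤j) j<π)

-- Rerouting R through Sub_{i,j}

module Rerouting {n : ℕ} (E : Fin n → Fin n → Set) (w W ℓ : ℕ) (SP : PathOfWellLinkedSets E W ℓ) (R : Linkage E)
  (R-links : IsLinkageFromTo E (PathOfWellLinkedSets.B SP (fromℕ ℓ)) (PathOfWellLinkedSets.A SP zero) R)
  (R-order : order E R ≡ 2 * w) (i j : Fin (suc ℓ)) (i≤j : toℕ i ≤ toℕ j) where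
  open PathOfWellLinkedSets SP
  open Routing E W
  open WellLinkedPath E SP

  private
    module F = Routing.Routing (rightward j)
    module K = Routing.Routing (leftward i)

  Rpaths : List (Path E)
  Rpaths = Linkage.paths R

  record Triple : Set where
    field
      r    : Path E
      r∈   : r ∈ Rpaths
      f    : Walk
      f∈   : f ∈ F.walks
      k    : Walk
      k∈   : k ∈ K.walks
      f⟶r : start E r ≡ target f
      r⟶k : source k ≡ end E r

  triple : ∀ {r} → r ∈ Rpaths → Triple
  triple {r} r∈ with targets-cover (rightward j) (∣B∣ (fromℕ ℓ)) (proj₁ (All.lookup R-links r∈))
                   | sources-cover (leftward i) (∣A∣ zero) (proj₂ (All.lookup R-links r∈))
  ... | f , f∈ , f⟶r | k , k∈ , r⟶k = record
    { r = r ; r∈ = r∈ ; f = f ; f∈ = f∈ ; k = k ; k∈ = k∈ ; f⟶r = sym f⟶r ; r⟶k = r⟶k }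

  triples : List Triple
  triples = mapWith∈ Rpaths triple

  length-triples : length triples ≡ 2 * w
  length-triples = trans (length-mapWith∈ Rpaths) R-order

  rPart fkPart : Triple → List (Fin n)
  rPart t = verts E (Triple.r t)
  fkPart t = vertices (Triple.f t) ++ vertices (Triple.k t)

  F-within : ∀ {f v} → f ∈ F.walks → v ∈ vertices f → RightOf j v
  F-within f∈ v∈ = All.lookup (All.lookup F.within f∈) v∈

  K-within : ∀ {k v} → k ∈ K.walks → v ∈ vertices k → LeftOf i v
  K-within k∈ v∈ = All.lookup (All.lookup K.within k∈) v∈

  rParts-disjoint : AllPairs (PairwiseDisjoint.Disjoint rPart) triples
  rParts-disjoint = AllPairs-mapWith∈⁺ Rpaths triple (λ _ _ r#r′ → r#r′) (Linkage.disjoint R)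

  fkParts-disjoint : AllPairs (PairwiseDisjoint.Disjoint fkPart) triples
  fkParts-disjoint = AllPairs-mapWith∈⁺ Rpaths triple (λ r∈ r′∈ → disjoint (triple r∈) (triple r′∈)) (Linkage.disjoint R)
    where
    disjoint : ∀ t t′ → PairwiseDisjoint.Disjoint (verts E) (Triple.r t) (Triple.r t′) → PairwiseDisjoint.Disjoint fkPart t t′
    disjoint t t′ r#r′ v v∈ v∈′ with ∈-++⁻ (vertices (Triple.f t)) v∈ | ∈-++⁻ (vertices (Triple.f t′)) v∈′
    ... | inj₁ v∈f | inj₁ v∈f′ = let f≡f′ = sharedVertex⇒≡ F.disjoint (Triple.f∈ t) (Triple.f∈ t′) v∈f v∈f′ in
      r#r′ _ (here refl) (subst (_∈ verts E (Triple.r t′))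
        (trans (Triple.f⟶r t′) (trans (cong target (sym f≡f′)) (sym (Triple.f⟶r t)))) (here refl))
    disjoint t t′ r#r′ v v∈ v∈′ | inj₁ v∈f | inj₂ v∈k′ =
      RightOf∩LeftOf≡∅ i≤j (F-within (Triple.f∈ t) v∈f) (K-within (Triple.k∈ t′) v∈k′)
    disjoint t t′ r#r′ v v∈ v∈′ | inj₂ v∈k | inj₁ v∈f′ =
      RightOf∩LeftOf≡∅ i≤j (F-within (Triple.f∈ t′) v∈f′) (K-within (Triple.k∈ t) v∈k)
    disjoint t t′ r#r′ v v∈ v∈′ | inj₂ v∈k | inj₂ v∈k′ =
      let k≡k′ = sharedVertex⇒≡ K.disjoint (Triple.k∈ t) (Triple.k∈ t′) v∈k v∈k′ in
      r#r′ _ (lastOf-∈ _ _) (subst (_∈ verts E (Triple.r t′))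
        (trans (sym (Triple.r⟶k t′)) (trans (cong source (sym k≡k′)) (Triple.r⟶k t))) (lastOf-∈ _ _))

  vertexLists : List (List (Fin n))
  vertexLists = map vertices F.walks ++ map (verts E) Rpaths ++ map vertices K.walks

  unionArcs : List Arc
  unionArcs = concat (map arcsOf vertexLists)

  data ArcOrigin (u v : Fin n) : Set where
    fromF : ∀ {f} → f ∈ F.walks → Consec (vertices f) u v → ArcOrigin u v
    fromR : ∀ {r} → r ∈ Rpaths → Consec (verts E r) u v → ArcOrigin u v
    fromK : ∀ {k} → k ∈ K.walks → Consec (vertices k) u v → ArcOrigin u v

  arcOrigin : ∀ {u v} → (u , v) ∈ unionArcs → ArcOrigin u v
  arcOrigin uv∈ with ∈-concat⁻′ (map arcsOf vertexLists) uv∈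
  ... | _ , uv∈arcs , arcs∈ with ∈-map⁻ arcsOf arcs∈
  ...   | xs , xs∈ , refl with ∈-++⁻ (map vertices F.walks) xs∈
  ...     | inj₁ xs∈F with ∈-map⁻ vertices xs∈F
  ...       | f , f∈ , refl = fromF f∈ (arcsOf⇒Consec uv∈arcs)
  arcOrigin uv∈ | _ , uv∈arcs , _ | xs , _ , refl | inj₂ xs∈RK with ∈-++⁻ (map (verts E) Rpaths) xs∈RK
  ...       | inj₁ xs∈R with ∈-map⁻ (verts E) xs∈R
  ...         | r , r∈ , refl = fromR r∈ (arcsOf⇒Consec uv∈arcs)
  arcOrigin uv∈ | _ , uv∈arcs , _ | xs , _ , refl | inj₂ _ | inj₂ xs∈K with ∈-map⁻ vertices xs∈K
  ...         | k , k∈ , refl = fromK k∈ (arcsOf⇒Consec uv∈arcs)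

  unionArc⇒E : ∀ {u v} → (u , v) ∈ unionArcs → E u v
  unionArc⇒E uv∈ with arcOrigin uv∈
  ... | fromF {f} _ c = Consec-linked (Walk.arcs f) c
  ... | fromR {r} _ c = Consec-linked (Path.arcs r) c
  ... | fromK {k} _ c = Consec-linked (Walk.arcs k) c

  linked-union : ∀ {xs} → xs ∈ vertexLists → Linked (ArcIn unionArcs) xs
  linked-union {xs} xs∈ = Linked.map (λ uv∈ → ∈-concat⁺′ uv∈ (∈-map⁺ arcsOf xs∈)) (linked-arcsOf xs)

  linked-F : ∀ {f} → f ∈ F.walks → Linked (ArcIn unionArcs) (vertices f)
  linked-F f∈ = linked-union (∈-++⁺ˡ (∈-map⁺ vertices f∈))

  linked-R : ∀ {r} → r ∈ Rpaths → Linked (ArcIn unionArcs) (verts E r)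
  linked-R r∈ = linked-union (∈-++⁺ʳ (map vertices F.walks) (∈-++⁺ˡ (∈-map⁺ (verts E) r∈)))

  linked-K : ∀ {k} → k ∈ K.walks → Linked (ArcIn unionArcs) (vertices k)
  linked-K k∈ = linked-union (∈-++⁺ʳ (map vertices F.walks) (∈-++⁺ʳ (map (verts E) Rpaths) (∈-map⁺ vertices k∈)))

  tripleWalk : ∀ t → let open Triple t in
    Linked (ArcIn unionArcs) (Walk.first f ∷ Walk.rest f ++ Path.rest r ++ Walk.rest k)
  tripleWalk t = linked-join (Walk.rest f) (linked-F f∈)
    (subst (λ z → Linked (ArcIn unionArcs) (z ∷ Path.rest r ++ Walk.rest k)) f⟶r
      (linked-join (Path.rest r) (linked-R r∈)
        (subst (λ z → Linked (ArcIn unionArcs) (z ∷ Walk.rest k)) r⟶k (linked-K k∈))))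
    where open Triple t

  tripleWalk-last : ∀ t → let open Triple t in
    lastOf (Walk.first f) (Walk.rest f ++ Path.rest r ++ Walk.rest k) ≡ target k
  tripleWalk-last t = begin
    lastOf (Walk.first f) (Walk.rest f ++ Path.rest r ++ Walk.rest k) ≡⟨ lastOf-++ (Walk.first f) (Walk.rest f) _ ⟩
    lastOf (target f) (Path.rest r ++ Walk.rest k)                     ≡⟨ cong (λ z → lastOf z (Path.rest r ++ Walk.rest k)) f⟶r ⟨
    lastOf (Path.first r) (Path.rest r ++ Walk.rest k)                 ≡⟨ lastOf-++ (Path.first r) (Path.rest r) (Walk.rest k) ⟩
    lastOf (end E r) (Walk.rest k)                                     ≡⟨ cong (λ z → lastOf z (Walk.rest k)) r⟶k ⟨
    target k                                                           ∎
    where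
    open Triple t
    open ≡-Reasoning

  Allowed : Arc → Set
  Allowed (u , v) = v ∉ₛ B j × u ∉ₛ A i

  allowed? : ∀ a → Dec (Allowed a)
  allowed? (u , v) = ¬? (v ∈? B j) ×-dec ¬? (u ∈? A i)

  -- No arc enters B(S_j) or leaves A(S_i), so a path can touch each of these sets only at its ends.
  auxArcs : List Arc
  auxArcs = filter allowed? unionArcs

  auxArc⁻ : ∀ {u v} → (u , v) ∈ auxArcs → (u , v) ∈ unionArcs × Allowed (u , v)
  auxArc⁻ = ∈-filter⁻ allowed? {xs = unionArcs}

  -- Cut the walk f r k after its last vertex in B(S_j), then at its first vertex in A(S_i).
  avoidingWalk : ∀ t {Z} → All (_∉ₛ Z) (rPart t) → All (_∉ₛ Z) (fkPart t) → AvoidingWalk auxArcs (B j) (A i) Z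
  avoidingWalk t {Z} r-avoids fk-avoids with lastHit (B j) _ _ (tripleWalk t)
  ... | inj₁ avoidsB = ⊥-elim (All.lookup avoidsB (here refl) (All.lookup F.sources (Triple.f∈ t)))
  ... | inj₂ (lastHitAt b zs b∈B lz avoidsB sameLast ⊆walk _) with firstHit (A i) b zs lz
  ...   | inj₁ avoidsA = ⊥-elim (All.lookup avoidsA (lastOf-∈ b zs)
            (subst (_∈ₛ A i) (sym (trans sameLast (tripleWalk-last t))) (All.lookup K.targets (Triple.k∈ t))))
  ...   | inj₂ (firstHitAt ys ly avoidsA last∈A ⊆zs _ All-rest) =
    b , ys ,
    Linked.map (λ (v∉B , u∉A , uv∈) → ∈-filter⁺ allowed? uv∈ (v∉B , u∉A)) (linked-heads (linked-tails ly avoidsA) (All-rest avoidsB)) ,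
    b∈B , last∈A , All.anti-mono ⊆zs (All.anti-mono ⊆walk walk-avoids)
    where
    open Triple t
    f-avoids = All.++⁻ˡ (vertices f) fk-avoids
    walk-avoids : All (_∉ₛ Z) (Walk.first f ∷ Walk.rest f ++ Path.rest r ++ Walk.rest k)
    walk-avoids = All.++⁺ f-avoids (All.++⁺ (All.tail r-avoids) (All.tail (All.++⁻ʳ (vertices f) fk-avoids)))

  unseparated : NoSeparatorBelow w auxArcs (B j) (A i)
  unseparated Z ∣Z∣<w with TwoPartFamily.missed rPart fkPart triples Z rParts-disjoint fkParts-disjoint (begin-strict
    ∣ Z ∣ + ∣ Z ∣     <⟨ +-mono-< ∣Z∣<w ∣Z∣<w ⟩
    w + w             ≡⟨ cong (w +_) (+-identityʳ w) ⟨
    2 * w             ≡⟨ length-triples ⟨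
    length triples    ∎)
    where open ≤-Reasoning
  ... | t , _ , r-avoids , fk-avoids = avoidingWalk t r-avoids fk-avoids

  opaque
    auxLinkage : LinkageOfOrder w (ArcIn auxArcs) (B j) (A i)
    auxLinkage = menger auxArcs w (B j) (A i) unseparated

  auxArc⇒E : ∀ {u v} → ArcIn auxArcs u v → E u v
  auxArc⇒E = unionArc⇒E ∘ proj₁ ∘ auxArc⁻

  F∩Sub⊆B : ∀ {f v} → f ∈ F.walks → v ∈ vertices f → SubVertex E SP i j v → v ∈ₛ B j
  F∩Sub⊆B f∈ v∈ sub = RightOf∩Between⊆B {i} {j} (F-within f∈ v∈) (SubVertex⇒Between {i} {j} sub)

  K∩Sub⊆A : ∀ {k v} → k ∈ K.walks → v ∈ vertices k → SubVertex E SP i j v → v ∈ₛ A i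
  K∩Sub⊆A k∈ v∈ sub = LeftOf∩Between⊆A {i} {j} (K-within k∈ v∈) (SubVertex⇒Between {i} {j} sub)

  private
    L = proj₁ auxLinkage

  auxLinkage-vertices : ∀ v → VertexOf (ArcIn auxArcs) L v → SubVertex E SP i j v →
    VertexOf E R v ⊎ InStartEnd (ArcIn auxArcs) L v
  auxLinkage-vertices v (p , p∈ , here refl) _ = inj₂ (p , p∈ , inj₁ refl)
  auxLinkage-vertices v (p , p∈ , there v∈rest) sub with ∈rest⇒arcInto (Path.arcs p) v∈rest
  ... | u , uv∈ with auxArc⁻ uv∈
  ...   | uv∈union , v∉B , _ with arcOrigin uv∈union
  ...     | fromF f∈ c = ⊥-elim (v∉B (F∩Sub⊆B f∈ (proj₂ (Consec⇒∈ c)) sub))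
  ...     | fromR r∈ c = inj₁ (_ , r∈ , proj₂ (Consec⇒∈ c))
  ...     | fromK k∈ c with ∈⇒last⊎arcOut (Path.arcs p) (there v∈rest)
  ...       | inj₁ v≡end = inj₂ (p , p∈ , inj₂ (sym v≡end))
  ...       | inj₂ (_ , vu′∈) = ⊥-elim (proj₂ (proj₂ (auxArc⁻ vu′∈)) (K∩Sub⊆A k∈ (proj₂ (Consec⇒∈ c)) sub))

  auxLinkage-arcs : ∀ u v → ArcOf (ArcIn auxArcs) L u v → SubArc E SP i j u v → ArcOf E R u v
  auxLinkage-arcs u v (p , p∈ , c) sub with auxArc⁻ (Consec-linked (Path.arcs p) c)
  ... | uv∈union , v∉B , u∉A with arcOrigin uv∈union
  ...   | fromF f∈ c′ = ⊥-elim (v∉B (F∩Sub⊆B f∈ (proj₂ (Consec⇒∈ c′)) (proj₂ (SubArc⇒SubVertex sub))))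
  ...   | fromR r∈ c′ = _ , r∈ , c′
  ...   | fromK k∈ c′ = ⊥-elim (u∉A (K∩Sub⊆A k∈ (proj₁ (Consec⇒∈ c′)) (proj₁ (SubArc⇒SubVertex sub))))

  R′ : Linkage E
  R′ = mapLinkage auxArc⇒E L

  R′-linkage : IsLinkageFromTo E (B j) (A i) R′ × order E R′ ≡ w
  R′-linkage = proj₂ (mapLinkageOfOrder auxArc⇒E auxLinkage)

  R′-vertices : ∀ v → VertexOf E R′ v → SubVertex E SP i j v → VertexOf E R v ⊎ InStartEnd E R′ v
  R′-vertices v v∈ sub =
    Data.Sum.map₂ (InStartEnd-mapLinkage⁺ auxArc⇒E L) (auxLinkage-vertices v (VertexOf-mapLinkage⁻ auxArc⇒E L v∈) sub)

  R′-arcs : ∀ u v → ArcOf E R′ u v → SubArc E SP i j u v → ArcOf E R u v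
  R′-arcs u v uv∈ sub = auxLinkage-arcs u v (ArcOf-mapLinkage⁻ auxArc⇒E L uv∈) sub

mainTheorem8 : (n : ℕ) (E : Fin n → Fin n → Set) (w W ℓ : ℕ) → 2 * w ≤ W →
    (SP : PathOfWellLinkedSets E W ℓ) →
    (R : Linkage E) →
    IsLinkageFromTo E (PathOfWellLinkedSets.B SP (fromℕ ℓ)) (PathOfWellLinkedSets.A SP zero) R →
    order E R ≡ 2 * w →
    (i j : Fin (suc ℓ)) → toℕ i ≤ toℕ j →
    Σ (Linkage E) λ R' →
      IsLinkageFromTo E (PathOfWellLinkedSets.B SP j) (PathOfWellLinkedSets.A SP i) R'
      × order E R' ≡ w
      × (∀ v → VertexOf E R' v → SubVertex E SP i j v → VertexOf E R v ⊎ InStartEnd E R' v)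
      × (∀ u v → ArcOf E R' u v → SubArc E SP i j u v → ArcOf E R u v)
mainTheorem8 n E w W ℓ _ SP R R-links R-order i j i≤j =
  R′ , proj₁ R′-linkage , proj₂ R′-linkage , R′-vertices , R′-arcs
  where open Rerouting E w W ℓ SP R R-links R-order i j i≤j
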